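{- Let $n,s,t\in\mathbb{Z}_{>0}$ and suppose there are constants $\alpha,\beta,\gamma\in(0,1)$ with $\alpha n\le t<s\le\beta n$ and $s-t\ge\gamma n$. Let $\varepsilon\in(0,s-t)$ and $\nu>0$. Let $\theta_{11},\theta_{12},\theta_{21},\theta_{22}>0$ satisfy: $\theta_{21}=\nu$; $\theta_{12}<\frac{6n}{6n^2+5s(n-t)}$; $s\theta_{i1}+(n-s)\theta_{i2}=1$ for $i=1,2$; $\frac{t-n}{n}<t\theta_{11}+(n-t)\theta_{21}-1<0$; and $\frac{st(s-t)}{4n^3}<t\theta_{12}+(n-t)\theta_{22}-1<\frac{s(n-t)}{n(n-s)}$. Let $A$ be the $n\times n$ block matrix whose top-left $t\times s$ block has all entries $\theta_{11}$, bottom-left $(n-t)\times s$ block all entries $\theta_{21}$, top-right $t\times(n-s)$ block all entries $\theta_{12}$, and bottom-right $(n-t)\times(n-s)$ block all entries $\theta_{22}$. Let $A^{(0)},A^{(1)},\dots$ be the SK iterates with input $(A,(\boldsymbol{1},\boldsymbol{1}))$ and let $K$ be the least $k$ with $\|\boldsymbol{r}(A^{(k)})-\boldsymbol{1}\|_1+\|\boldsymbol{c}(A^{(k)})-\boldsymbol{1}\|_1\le\varepsilon$. Then $K=\Omega(-\log\nu-\log\varepsilon)$.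
   Context: SK with input $(A,(\boldsymbol{1},\boldsymbol{1}))$: $A^{(0)}_{ij}=A_{ij}/r_i(A)$; odd $k$: $A^{(k)}_{ij}=A^{(k-1)}_{ij}/c_j(A^{(k-1)})$; even $k\ge2$: $A^{(k)}_{ij}=A^{(k-1)}_{ij}/r_i(A^{(k-1)})$, with $r_i,c_j$ row/column sums and $\boldsymbol{r},\boldsymbol{c}$ their vectors. The constant implied by $\Omega$ depends only on the constants $\alpha,\beta,\gamma$.
   Formalization: The constants α, β, γ and the parameters ε, ν, θ₁₁, θ₁₂, θ₂₁, θ₂₂ are rational numbers. -}

module Defs where

open import Data.Nat as ℕ using (ℕ; zero; suc)
open import Data.Integer using (+_)
open import Data.Fin using (Fin; toℕ) renaming (zero to fzero; suc to fsuc)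
open import Data.Bool using (Bool; true; false; if_then_else_)
open import Data.Rational using (ℚ; 0ℚ; 1ℚ; _+_; _*_; _-_; _÷_; ∣_∣; _/_; ≢-nonZero)
open import Data.Rational.Properties using (_≟_)
open import Relation.Nullary using (yes; no)

ℕtoℚ : ℕ → ℚ
ℕtoℚ n = (+ n) / 1

-- division with the convention x ÷ 0 := 0 (never used on the positive
-- matrices considered: all row/column sums are positive)
_÷₀_ : ℚ → ℚ → ℚ
x ÷₀ y with y ≟ 0ℚ
... | yes _ = 0ℚ
... | no y≢0 = _÷_ x y {{≢-nonZero y≢0}}

_^ℚ_ : ℚ → ℕ → ℚ
x ^ℚ zero = 1ℚ
x ^ℚ suc k = x * (x ^ℚ k)

∑ : ∀ {n} → (Fin n → ℚ) → ℚ
∑ {zero} f = 0ℚ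
∑ {suc n} f = f fzero + ∑ (λ i → f (fsuc i))

Mat : ℕ → Set
Mat n = Fin n → Fin n → ℚ

rowSum : ∀ {n} → Mat n → Fin n → ℚ
rowSum A i = ∑ (λ j → A i j)

colSum : ∀ {n} → Mat n → Fin n → ℚ
colSum A j = ∑ (λ i → A i j)

rowNormalize : ∀ {n} → Mat n → Mat n
rowNormalize A i j = A i j ÷₀ rowSum A i

colNormalize : ∀ {n} → Mat n → Mat n
colNormalize A i j = A i j ÷₀ colSum A j

isOdd : ℕ → Bool
isOdd zero = false
isOdd (suc k) = if isOdd k then false else true

-- SK iterates with input (A, (1,1)):
-- A⁽⁰⁾ = row-normalised A; odd k: column-normalise; even k ≥ 2: row-normalise
SK : ∀ {n} → Mat n → ℕ → Mat n
SK A zero = rowNormalize A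
SK A (suc k) = if isOdd (suc k) then colNormalize (SK A k) else rowNormalize (SK A k)

marginalError : ∀ {n} → Mat n → ℚ
marginalError M = ∑ (λ i → ∣ rowSum M i - 1ℚ ∣) + ∑ (λ j → ∣ colSum M j - 1ℚ ∣)

blockMatrix : (n s t : ℕ) (θ₁₁ θ₁₂ θ₂₁ θ₂₂ : ℚ) → Mat n
blockMatrix n s t θ₁₁ θ₁₂ θ₂₁ θ₂₂ i j =
  if toℕ i ℕ.<ᵇ t
    then (if toℕ j ℕ.<ᵇ s then θ₁₁ else θ₁₂)
    else (if toℕ j ℕ.<ᵇ s then θ₂₁ else θ₂₂)

{-# OPTIONS --safe #-}
module Submission where

-- On a 2 × 2 block matrix every SK iterate is again a block matrix, so SK is a
-- recursion on four numbers, the block entries, weighted by the block sizes.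
-- With μ = α (1 − β) / 3 every iterate is μ-regular: a₁₂ and a₂₁ lie below a₁₁
-- and a₂₂, and a₁₂ a₂₁ ≤ (1 − μ) a₁₁ a₂₂. For a μ-regular pattern one
-- normalisation step multiplies the marginal error by at least μ³ (the new
-- imbalance is the old one times a gap of order μ / n) and the entry a₂₁ by
-- at most 1 / μ. Mass conservation shows that an error below s − t forces
-- a₂₁ ≥ (s − t) / (2 n²). Starting from a₂₁ = ν and an error of order μ³ γ n,
-- stopping at error ε after K steps therefore needs μ³ γ² (μ⁴)ᴷ < 8 ν ε.

open import Data.Bool using (Bool; true; false; if_then_else_)
open import Data.Bool.Properties using (if-float)
open import Data.Empty using (⊥-elim)
open import Data.Fin using (Fin; toℕ) renaming (zero to fzero; suc to fsuc)
import Data.Integer as ℤ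
import Data.Integer.Properties as ℤP
open import Data.List using (_∷_; [])
open import Data.Nat as ℕ using (ℕ; zero; suc)
import Data.Nat.Properties as ℕP
open import Data.Nat.Coprimality as Coprimality using (1-coprimeTo)
open import Data.Product using (Σ; _×_; _,_; proj₁; proj₂)
open import Data.Rational
  using (ℚ; 0ℚ; 1ℚ; _+_; _*_; _-_; -_; _≤_; _<_; ∣_∣; _/_; mkℚ; *≤*; *<*; positive; nonNegative; ≢-nonZero)
open import Data.Rational.Properties
open import Data.Sum using (inj₁; inj₂)
open import Level using (0ℓ)
open import Relation.Binary.PropositionalEquality
open import Relation.Nullary using (¬_)
open import Relation.Nullary.Decidable using (dec⇒maybe; yes; no)
open import Tactic.RingSolver using (solve-∀; solve)
open import Tactic.RingSolver.Core.AlmostCommutativeRing using (AlmostCommutativeRing; fromCommutativeRing)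
open import Defs

-- Ordered-field arithmetic in ℚ

ℚ-ring : AlmostCommutativeRing 0ℓ 0ℓ
ℚ-ring = fromCommutativeRing +-*-commutativeRing (λ x → dec⇒maybe (0ℚ ≟ x))

p<q⇒0<q-p : ∀ {p q} → p < q → 0ℚ < q - p
p<q⇒0<q-p {p} {q} p<q = begin-strict
  0ℚ    ≡⟨ sym (+-inverseʳ p) ⟩
  p - p <⟨ +-monoˡ-< (- p) p<q ⟩
  q - p ∎
  where open ≤-Reasoning

p≤q⇒0≤q-p : ∀ {p q} → p ≤ q → 0ℚ ≤ q - p
p≤q⇒0≤q-p {p} {q} p≤q = begin
  0ℚ    ≡⟨ sym (+-inverseʳ p) ⟩
  p - p ≤⟨ +-monoˡ-≤ (- p) p≤q ⟩
  q - p ∎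
  where open ≤-Reasoning

<-by-difference : ∀ {p q} r → q - p ≡ r → 0ℚ < r → p < q
<-by-difference {p} {q} r q-p≡r 0<r = begin-strict
  p            ≡⟨ sym (+-identityˡ p) ⟩
  0ℚ + p       <⟨ +-monoˡ-< p (subst (0ℚ <_) (sym q-p≡r) 0<r) ⟩
  (q - p) + p  ≡⟨ solve (q ∷ p ∷ []) ℚ-ring ⟩
  q            ∎
  where open ≤-Reasoning

≤-by-difference : ∀ {p q} r → q - p ≡ r → 0ℚ ≤ r → p ≤ q
≤-by-difference {p} {q} r q-p≡r 0≤r = begin
  p            ≡⟨ sym (+-identityˡ p) ⟩
  0ℚ + p       ≤⟨ +-monoˡ-≤ p (subst (0ℚ ≤_) (sym q-p≡r) 0≤r) ⟩
  (q - p) + p  ≡⟨ solve (q ∷ p ∷ []) ℚ-ring ⟩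
  q            ∎
  where open ≤-Reasoning

p-r≤p : ∀ p {r} → 0ℚ ≤ r → p - r ≤ p
p-r≤p p {r} 0≤r = ≤-by-difference r (solve (p ∷ r ∷ []) ℚ-ring) 0≤r

p≤q⇒p≤r+q : ∀ {p q r} → 0ℚ ≤ r → p ≤ q → p ≤ r + q
p≤q⇒p≤r+q {p} {q} {r} 0≤r p≤q = subst (_≤ r + q) (+-identityˡ p) (+-mono-≤ 0≤r p≤q)

p-q<0⇒p<q : ∀ {p q} → p - q < 0ℚ → p < q
p-q<0⇒p<q {p} {q} p-q<0 = <-by-difference (- (p - q)) (solve (p ∷ q ∷ []) ℚ-ring) (neg-antimono-< p-q<0)

+-pos : ∀ {p q} → 0ℚ < p → 0ℚ < q → 0ℚ < p + q
+-pos {p} {q} 0<p 0<q = subst (_< p + q) (+-identityˡ 0ℚ) (+-mono-< 0<p 0<q)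

+-nonNeg : ∀ {p q} → 0ℚ ≤ p → 0ℚ ≤ q → 0ℚ ≤ p + q
+-nonNeg {p} {q} 0≤p 0≤q = subst (_≤ p + q) (+-identityˡ 0ℚ) (+-mono-≤ 0≤p 0≤q)

+-pos-nonNeg : ∀ {p q} → 0ℚ < p → 0ℚ ≤ q → 0ℚ < p + q
+-pos-nonNeg {p} {q} 0<p 0≤q = subst (_< p + q) (+-identityˡ 0ℚ) (+-mono-<-≤ 0<p 0≤q)

+-nonNeg-pos : ∀ {p q} → 0ℚ ≤ p → 0ℚ < q → 0ℚ < p + q
+-nonNeg-pos {p} {q} 0≤p 0<q = subst (_< p + q) (+-identityˡ 0ℚ) (+-mono-≤-< 0≤p 0<q)

*-pos : ∀ {p q} → 0ℚ < p → 0ℚ < q → 0ℚ < p * q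
*-pos {p} {q} 0<p 0<q = positive⁻¹ (p * q) {{pos*pos⇒pos p {{positive 0<p}} q {{positive 0<q}}}}

*-nonNeg : ∀ {p q} → 0ℚ ≤ p → 0ℚ ≤ q → 0ℚ ≤ p * q
*-nonNeg {p} {q} 0≤p 0≤q = nonNegative⁻¹ (p * q) {{nonNeg*nonNeg⇒nonNeg p {{nonNegative 0≤p}} q {{nonNegative 0≤q}}}}

*-monoˡ-≤-0≤ : ∀ {p q r} → 0ℚ ≤ r → p ≤ q → r * p ≤ r * q
*-monoˡ-≤-0≤ {r = r} 0≤r = *-monoˡ-≤-nonNeg r {{nonNegative 0≤r}}

*-monoʳ-≤-0≤ : ∀ {p q r} → 0ℚ ≤ r → p ≤ q → p * r ≤ q * r
*-monoʳ-≤-0≤ {r = r} 0≤r = *-monoʳ-≤-nonNeg r {{nonNegative 0≤r}}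

*-monoˡ-<-0< : ∀ {p q r} → 0ℚ < r → p < q → r * p < r * q
*-monoˡ-<-0< {r = r} 0<r = *-monoʳ-<-pos r {{positive 0<r}}

*-monoʳ-<-0< : ∀ {p q r} → 0ℚ < r → p < q → p * r < q * r
*-monoʳ-<-0< {r = r} 0<r = *-monoˡ-<-pos r {{positive 0<r}}

*-mono-≤-0≤ : ∀ {p q r s} → 0ℚ ≤ p → 0ℚ ≤ r → p ≤ q → r ≤ s → p * r ≤ q * s
*-mono-≤-0≤ 0≤p 0≤r p≤q r≤s =
  ≤-trans (*-monoʳ-≤-0≤ 0≤r p≤q) (*-monoˡ-≤-0≤ (≤-trans 0≤p p≤q) r≤s)

*-mono-<-0< : ∀ {p q r s} → 0ℚ < p → 0ℚ < r → p < q → r < s → p * r < q * s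
*-mono-<-0< 0<p 0<r p<q r<s =
  <-trans (*-monoʳ-<-0< 0<r p<q) (*-monoˡ-<-0< (<-trans 0<p p<q) r<s)

*-cancelˡ-<-0≤ : ∀ {p q r} → 0ℚ ≤ r → r * p < r * q → p < q
*-cancelˡ-<-0≤ {r = r} 0≤r = *-cancelˡ-<-nonNeg r {{nonNegative 0≤r}}

*-cancelʳ-≤-0< : ∀ {p q r} → 0ℚ < r → p * r ≤ q * r → p ≤ q
*-cancelʳ-≤-0< {r = r} 0<r = *-cancelʳ-≤-pos r {{positive 0<r}}

*-cancelʳ-≡-0< : ∀ {p q r} → 0ℚ < r → p * r ≡ q * r → p ≡ q
*-cancelʳ-≡-0< 0<r pr≡qr =
  ≤-antisym (*-cancelʳ-≤-0< 0<r (≤-reflexive pr≡qr)) (*-cancelʳ-≤-0< 0<r (≤-reflexive (sym pr≡qr)))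

*-cancelʳ-≤-rescaled : ∀ {x y x′ y′ r} → 0ℚ < r → x′ * r ≡ x → y′ * r ≡ y → x ≤ y → x′ ≤ y′
*-cancelʳ-≤-rescaled 0<r x′r≡x y′r≡y x≤y = *-cancelʳ-≤-0< 0<r (subst₂ _≤_ (sym x′r≡x) (sym y′r≡y) x≤y)

0≤p*r⇒0≤p : ∀ {p r} → 0ℚ < r → 0ℚ ≤ p * r → 0ℚ ≤ p
0≤p*r⇒0≤p {p} {r} 0<r 0≤pr = *-cancelʳ-≤-0< 0<r (subst (_≤ p * r) (sym (*-zeroˡ r)) 0≤pr)

0<p*r⇒0<p : ∀ {p r} → 0ℚ ≤ r → 0ℚ < p * r → 0ℚ < p
0<p*r⇒0<p {p} {r} 0≤r 0<pr =
  *-cancelˡ-<-0≤ 0≤r (subst₂ _<_ (sym (*-zeroʳ r)) (*-comm p r) 0<pr)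

<-by-scaled-difference : ∀ {p q r} e → 0ℚ < r → r * (q - p) ≡ e → 0ℚ < e → p < q
<-by-scaled-difference {p} {q} {r} e 0<r r[q-p]≡e 0<e =
  <-by-difference (q - p) refl (0<p*r⇒0<p (<⇒≤ 0<r) (subst (0ℚ <_) (trans (sym r[q-p]≡e) (*-comm r (q - p))) 0<e))

≤-by-scaled-difference : ∀ {p q r} e → 0ℚ < r → r * (q - p) ≡ e → 0ℚ ≤ e → p ≤ q
≤-by-scaled-difference {p} {q} {r} e 0<r r[q-p]≡e 0≤e =
  ≤-by-difference (q - p) refl (0≤p*r⇒0≤p 0<r (subst (0ℚ ≤_) (trans (sym r[q-p]≡e) (*-comm r (q - p))) 0≤e))

x≡1⇒e+k*[x-1]≡e : ∀ e k {x} → x ≡ 1ℚ → e + k * (x - 1ℚ) ≡ e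
x≡1⇒e+k*[x-1]≡e e k refl = trans (cong (e +_) (*-zeroʳ k)) (+-identityʳ e)

p≤∣p∣ : ∀ p → p ≤ ∣ p ∣
p≤∣p∣ p with ≤-total 0ℚ p
... | inj₁ 0≤p = ≤-reflexive (sym (0≤p⇒∣p∣≡p 0≤p))
... | inj₂ p≤0 = ≤-trans p≤0 (0≤∣p∣ p)

∣w*p∣≡w*∣p∣ : ∀ {w} p → 0ℚ ≤ w → ∣ w * p ∣ ≡ w * ∣ p ∣
∣w*p∣≡w*∣p∣ {w} p 0≤w = trans (∣p*q∣≡∣p∣*∣q∣ w p) (cong (_* ∣ p ∣) (0≤p⇒∣p∣≡p 0≤w))

w*p≤w*∣p∣ : ∀ {w} p → 0ℚ ≤ w → w * p ≤ w * ∣ p ∣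
w*p≤w*∣p∣ p 0≤w = *-monoˡ-≤-0≤ 0≤w (p≤∣p∣ p)

w*-p≤w*∣p∣ : ∀ {w} p → 0ℚ ≤ w → w * (- p) ≤ w * ∣ p ∣
w*-p≤w*∣p∣ {w} p 0≤w = subst (λ z → w * (- p) ≤ w * z) (∣-p∣≡∣p∣ p) (w*p≤w*∣p∣ (- p) 0≤w)

x÷₀y*y≡x : ∀ x {y} → 0ℚ < y → (x ÷₀ y) * y ≡ x
x÷₀y*y≡x x {y} 0<y with y ≟ 0ℚ
... | yes y≡0 = ⊥-elim (<-irrefl (sym y≡0) 0<y)
... | no y≢0 =
  trans (*-assoc x _ y) (trans (cong (x *_) (*-inverseˡ y {{≢-nonZero y≢0}})) (*-identityʳ x))

÷₀-identityʳ : ∀ x → x ÷₀ 1ℚ ≡ x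
÷₀-identityʳ = *-identityʳ

÷₀-pos : ∀ {x y} → 0ℚ < x → 0ℚ < y → 0ℚ < x ÷₀ y
÷₀-pos {x} 0<x 0<y = 0<p*r⇒0<p (<⇒≤ 0<y) (subst (0ℚ <_) (sym (x÷₀y*y≡x x 0<y)) 0<x)

x<y÷₀z⇒x*z<y : ∀ {x y z} → 0ℚ < z → x < y ÷₀ z → x * z < y
x<y÷₀z⇒x*z<y {x} {y} {z} 0<z x<y÷₀z = subst (x * z <_) (x÷₀y*y≡x y 0<z) (*-monoʳ-<-0< 0<z x<y÷₀z)

y÷₀z<x⇒y<x*z : ∀ {x y z} → 0ℚ < z → y ÷₀ z < x → y < x * z
y÷₀z<x⇒y<x*z {x} {y} {z} 0<z y÷₀z<x = subst (_< x * z) (x÷₀y*y≡x y 0<z) (*-monoʳ-<-0< 0<z y÷₀z<x)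

ℕtoℚ≡mkℚ : ∀ m → ℕtoℚ m ≡ mkℚ (ℤ.+ m) 0 (Coprimality.sym (1-coprimeTo m))
ℕtoℚ≡mkℚ m = normalize-coprime (Coprimality.sym (1-coprimeTo m))

ℕtoℚ-mono-< : ∀ {m k} → m ℕ.< k → ℕtoℚ m < ℕtoℚ k
ℕtoℚ-mono-< {m} {k} m<k rewrite ℕtoℚ≡mkℚ m | ℕtoℚ≡mkℚ k =
  *<* (subst₂ ℤ._<_ (sym (ℤP.*-identityʳ (ℤ.+ m))) (sym (ℤP.*-identityʳ (ℤ.+ k))) (ℤ.+<+ m<k))

ℕtoℚ-mono-≤ : ∀ {m k} → m ℕ.≤ k → ℕtoℚ m ≤ ℕtoℚ k
ℕtoℚ-mono-≤ {m} {k} m≤k rewrite ℕtoℚ≡mkℚ m | ℕtoℚ≡mkℚ k =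
  *≤* (subst₂ ℤ._≤_ (sym (ℤP.*-identityʳ (ℤ.+ m))) (sym (ℤP.*-identityʳ (ℤ.+ k))) (ℤ.+≤+ m≤k))

ℕtoℚ-cancel-< : ∀ {m k} → ℕtoℚ m < ℕtoℚ k → m ℕ.< k
ℕtoℚ-cancel-< M<K = ℕP.≰⇒> (λ k≤m → <-irrefl refl (<-≤-trans M<K (ℕtoℚ-mono-≤ k≤m)))

0≤ℕtoℚ : ∀ m → 0ℚ ≤ ℕtoℚ m
0≤ℕtoℚ m = ℕtoℚ-mono-≤ {0} {m} ℕ.z≤n

ℕtoℚ-suc : ∀ m → ℕtoℚ (suc m) ≡ 1ℚ + ℕtoℚ m
ℕtoℚ-suc m = sym (trans (cong (1ℚ +_) (ℕtoℚ≡mkℚ m))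
  (/-cong {p₁ = ℤ.+ 1 ℤ.* ℤ.+ 1 ℤ.+ ℤ.+ m ℤ.* ℤ.+ 1} (cong (ℤ._+_ (ℤ.+ 1)) (ℤP.*-identityʳ (ℤ.+ m))) refl))

^ℚ-pos : ∀ {x} k → 0ℚ < x → 0ℚ < x ^ℚ k
^ℚ-pos zero    0<x = positive⁻¹ 1ℚ
^ℚ-pos (suc k) 0<x = *-pos 0<x (^ℚ-pos k 0<x)

^ℚ-distribʳ-* : ∀ x y k → (x * y) ^ℚ k ≡ x ^ℚ k * y ^ℚ k
^ℚ-distribʳ-* x y zero    = refl
^ℚ-distribʳ-* x y (suc k) = begin
  x * y * (x * y) ^ℚ k          ≡⟨ cong (x * y *_) (^ℚ-distribʳ-* x y k) ⟩
  x * y * (x ^ℚ k * y ^ℚ k)     ≡⟨ interchange x y (x ^ℚ k) (y ^ℚ k) ⟩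
  x * x ^ℚ k * (y * y ^ℚ k)     ∎
  where
  open ≡-Reasoning
  interchange : ∀ x y u v → x * y * (u * v) ≡ x * u * (y * v)
  interchange = solve-∀ ℚ-ring

1≤^ℚ : ∀ {x} k → 1ℚ ≤ x → 1ℚ ≤ x ^ℚ k
1≤^ℚ zero    1≤x = ≤-refl
1≤^ℚ (suc k) 1≤x = ≤-trans (≤-reflexive (sym (*-identityˡ 1ℚ)))
  (*-mono-≤-0≤ (nonNegative⁻¹ 1ℚ) (nonNegative⁻¹ 1ℚ) 1≤x (1≤^ℚ k 1≤x))

^ℚ-+1 : ∀ x k → x ^ℚ (k ℕ.+ 1) ≡ x * x ^ℚ k
^ℚ-+1 x k = cong (x ^ℚ_) (ℕP.+-comm k 1)

∑-cong : ∀ {n} {f g : Fin n → ℚ} → (∀ i → f i ≡ g i) → ∑ f ≡ ∑ g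
∑-cong {zero}  f≗g = refl
∑-cong {suc n} f≗g = cong₂ _+_ (f≗g fzero) (∑-cong (λ i → f≗g (fsuc i)))

∑-const : ∀ n y → ∑ {n} (λ _ → y) ≡ ℕtoℚ n * y
∑-const zero    y = sym (*-zeroˡ y)
∑-const (suc n) y = begin
  y + ∑ {n} (λ _ → y)  ≡⟨ cong (y +_) (∑-const n y) ⟩
  y + ℕtoℚ n * y       ≡⟨ sym (cong (_+ ℕtoℚ n * y) (*-identityˡ y)) ⟩
  1ℚ * y + ℕtoℚ n * y  ≡⟨ sym (*-distribʳ-+ y 1ℚ (ℕtoℚ n)) ⟩
  (1ℚ + ℕtoℚ n) * y    ≡⟨ cong (_* y) (sym (ℕtoℚ-suc n)) ⟩
  ℕtoℚ (suc n) * y     ∎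
  where open ≡-Reasoning

∑-threshold : ∀ {n t} → t ℕ.≤ n → ∀ x y →
  ∑ {n} (λ i → if toℕ i ℕ.<ᵇ t then x else y) ≡ ℕtoℚ t * x + (ℕtoℚ n - ℕtoℚ t) * y
∑-threshold {n} {zero} _ x y = trans (∑-const n y) (nothing-above (ℕtoℚ n) x y)
  where
  nothing-above : ∀ N x y → N * y ≡ 0ℚ * x + (N - 0ℚ) * y
  nothing-above = solve-∀ ℚ-ring
∑-threshold {suc n} {suc t} (ℕ.s≤s t≤n) x y = begin
  x + ∑ {n} (λ i → if toℕ i ℕ.<ᵇ t then x else y)
    ≡⟨ cong (x +_) (∑-threshold t≤n x y) ⟩
  x + (ℕtoℚ t * x + (ℕtoℚ n - ℕtoℚ t) * y)
    ≡⟨ one-more (ℕtoℚ t) (ℕtoℚ n) x y ⟩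
  (1ℚ + ℕtoℚ t) * x + ((1ℚ + ℕtoℚ n) - (1ℚ + ℕtoℚ t)) * y
    ≡⟨ sym (cong₂ (λ T N → T * x + (N - T) * y) (ℕtoℚ-suc t) (ℕtoℚ-suc n)) ⟩
  ℕtoℚ (suc t) * x + (ℕtoℚ (suc n) - ℕtoℚ (suc t)) * y ∎
  where
  open ≡-Reasoning
  one-more : ∀ T N x y → x + (T * x + (N - T) * y) ≡ (1ℚ + T) * x + ((1ℚ + N) - (1ℚ + T)) * y
  one-more = solve-∀ ℚ-ring

-- Block patterns and their marginals

weighted-deviation-swap : ∀ {u v x y} → 0ℚ ≤ u → 0ℚ ≤ v → u * x + v * y ≡ u + v →
  v * ∣ y - 1ℚ ∣ ≡ u * ∣ x - 1ℚ ∣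
weighted-deviation-swap {u} {v} {x} {y} 0≤u 0≤v mass = begin
  v * ∣ y - 1ℚ ∣          ≡⟨ sym (∣w*p∣≡w*∣p∣ (y - 1ℚ) 0≤v) ⟩
  ∣ v * (y - 1ℚ) ∣        ≡⟨ cong ∣_∣ opposite ⟩
  ∣ - (u * (x - 1ℚ)) ∣    ≡⟨ ∣-p∣≡∣p∣ (u * (x - 1ℚ)) ⟩
  ∣ u * (x - 1ℚ) ∣        ≡⟨ ∣w*p∣≡w*∣p∣ (x - 1ℚ) 0≤u ⟩
  u * ∣ x - 1ℚ ∣          ∎
  where
  open ≡-Reasoning
  opposite : v * (y - 1ℚ) ≡ - (u * (x - 1ℚ))
  opposite = begin
    v * (y - 1ℚ)                              ≡⟨ solve (u ∷ v ∷ x ∷ y ∷ []) ℚ-ring ⟩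
    (u * x + v * y) - (u + v) - u * (x - 1ℚ)  ≡⟨ cong (λ m → m - (u + v) - u * (x - 1ℚ)) mass ⟩
    (u + v) - (u + v) - u * (x - 1ℚ)          ≡⟨ solve (u ∷ v ∷ x ∷ []) ℚ-ring ⟩
    - (u * (x - 1ℚ))                          ∎

record Block : Set where
  constructor block
  field
    a₁₁ a₁₂ a₂₁ a₂₂ : ℚ
open Block public

block-cong : ∀ {a b c d a′ b′ c′ d′} → a ≡ a′ → b ≡ b′ → c ≡ c′ → d ≡ d′ →
  block a b c d ≡ block a′ b′ c′ d′
block-cong refl refl refl refl = refl

transpose : Block → Block
transpose (block a b c d) = block a c b d

-- A block pattern whose row blocks have h₁ and h₂ rows and whose column
-- blocks have w₁ and w₂ columns: a row sum of the matrix is a weighted sum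
-- of a row of the pattern.
module Weighted (h₁ h₂ w₁ w₂ : ℚ) where

  rowSum₁ rowSum₂ colSum₁ colSum₂ : Block → ℚ
  rowSum₁ X = w₁ * a₁₁ X + w₂ * a₁₂ X
  rowSum₂ X = w₁ * a₂₁ X + w₂ * a₂₂ X
  colSum₁ X = h₁ * a₁₁ X + h₂ * a₂₁ X
  colSum₂ X = h₁ * a₁₂ X + h₂ * a₂₂ X

  rowStep colStep : Block → Block
  rowStep X = block (a₁₁ X ÷₀ rowSum₁ X) (a₁₂ X ÷₀ rowSum₁ X) (a₂₁ X ÷₀ rowSum₂ X) (a₂₂ X ÷₀ rowSum₂ X)
  colStep X = block (a₁₁ X ÷₀ colSum₁ X) (a₁₂ X ÷₀ colSum₂ X) (a₂₁ X ÷₀ colSum₁ X) (a₂₂ X ÷₀ colSum₂ X)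

  error : Block → ℚ
  error X = (h₁ * ∣ rowSum₁ X - 1ℚ ∣ + h₂ * ∣ rowSum₂ X - 1ℚ ∣)
          + (w₁ * ∣ colSum₁ X - 1ℚ ∣ + w₂ * ∣ colSum₂ X - 1ℚ ∣)

  nextSK : ℕ → Block → Block
  nextSK k Y = if isOdd (suc k) then colStep Y else rowStep Y

  blockSK : Block → ℕ → Block
  blockSK X zero    = rowStep X
  blockSK X (suc k) = nextSK k (blockSK X k)

  RowsBalanced ColsBalanced : Block → Set
  RowsBalanced X = rowSum₁ X ≡ 1ℚ × rowSum₂ X ≡ 1ℚ
  ColsBalanced X = colSum₁ X ≡ 1ℚ × colSum₂ X ≡ 1ℚ

  total-mass : ∀ X → w₁ * colSum₁ X + w₂ * colSum₂ X ≡ h₁ * rowSum₁ X + h₂ * rowSum₂ X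
  total-mass (block a b c d) = mass
    where
    mass : w₁ * (h₁ * a + h₂ * c) + w₂ * (h₁ * b + h₂ * d) ≡ h₁ * (w₁ * a + w₂ * b) + h₂ * (w₁ * c + w₂ * d)
    mass = solve (a ∷ b ∷ c ∷ d ∷ h₁ ∷ h₂ ∷ w₁ ∷ w₂ ∷ []) ℚ-ring

  rowStep-balanced : ∀ X → RowsBalanced X → rowStep X ≡ X
  rowStep-balanced (block a b c d) (row₁ , row₂) = trans
    (cong₂ (λ r₁ r₂ → block (a ÷₀ r₁) (b ÷₀ r₁) (c ÷₀ r₂) (d ÷₀ r₂)) row₁ row₂)
    (block-cong (÷₀-identityʳ a) (÷₀-identityʳ b) (÷₀-identityʳ c) (÷₀-identityʳ d))

  colSums-balance : h₁ + h₂ ≡ w₁ + w₂ → ∀ X → RowsBalanced X → w₁ * colSum₁ X + w₂ * colSum₂ X ≡ w₁ + w₂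
  colSums-balance sizes X (row₁ , row₂) = begin
    w₁ * colSum₁ X + w₂ * colSum₂ X  ≡⟨ total-mass X ⟩
    h₁ * rowSum₁ X + h₂ * rowSum₂ X  ≡⟨ cong₂ (λ r₁ r₂ → h₁ * r₁ + h₂ * r₂) row₁ row₂ ⟩
    h₁ * 1ℚ + h₂ * 1ℚ                ≡⟨ cong₂ _+_ (*-identityʳ h₁) (*-identityʳ h₂) ⟩
    h₁ + h₂                          ≡⟨ sizes ⟩
    w₁ + w₂                          ∎
    where open ≡-Reasoning

  module _ (0≤h₁ : 0ℚ ≤ h₁) (0≤h₂ : 0ℚ ≤ h₂) (0≤w₁ : 0ℚ ≤ w₁) (0≤w₂ : 0ℚ ≤ w₂)
           (sizes : h₁ + h₂ ≡ w₁ + w₂) where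

    error-rowsBalanced : ∀ X → RowsBalanced X →
      error X ≡ w₁ * ∣ colSum₁ X - 1ℚ ∣ + w₁ * ∣ colSum₁ X - 1ℚ ∣
    error-rowsBalanced X rows@(row₁ , row₂) = begin
      error X
        ≡⟨ cong₂ (λ r₁ r₂ → (h₁ * ∣ r₁ - 1ℚ ∣ + h₂ * ∣ r₂ - 1ℚ ∣) + cols) row₁ row₂ ⟩
      (h₁ * 0ℚ + h₂ * 0ℚ) + cols
        ≡⟨ cong₂ (λ x y → (x + y) + cols) (*-zeroʳ h₁) (*-zeroʳ h₂) ⟩
      0ℚ + cols
        ≡⟨ +-identityˡ cols ⟩
      w₁ * ∣ colSum₁ X - 1ℚ ∣ + w₂ * ∣ colSum₂ X - 1ℚ ∣
        ≡⟨ cong (w₁ * ∣ colSum₁ X - 1ℚ ∣ +_) (weighted-deviation-swap 0≤w₁ 0≤w₂ (colSums-balance sizes X rows)) ⟩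
      w₁ * ∣ colSum₁ X - 1ℚ ∣ + w₁ * ∣ colSum₁ X - 1ℚ ∣ ∎
      where
      open ≡-Reasoning
      cols : ℚ
      cols = w₁ * ∣ colSum₁ X - 1ℚ ∣ + w₂ * ∣ colSum₂ X - 1ℚ ∣

    colSum₂-deviation≤error : ∀ X → w₂ * (colSum₂ X - 1ℚ) ≤ error X
    colSum₂-deviation≤error X =
      p≤q⇒p≤r+q (+-nonNeg (*-nonNeg 0≤h₁ (0≤∣p∣ _)) (*-nonNeg 0≤h₂ (0≤∣p∣ _)))
        (p≤q⇒p≤r+q (*-nonNeg 0≤w₁ (0≤∣p∣ _)) (w*p≤w*∣p∣ (colSum₂ X - 1ℚ) 0≤w₂))

    -- Mass conservation: the error is at least twice the signed deviation of
    -- the first row block minus that of the first column block.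
    error-separation : ∀ X → 0ℚ ≤ a₁₂ X →
      (w₁ - h₁) + (w₁ - h₁) ≤ error X + (w₁ * h₂ * a₂₁ X + w₁ * h₂ * a₂₁ X)
    error-separation X@(block a b c d) 0≤b = begin
      (w₁ - h₁) + (w₁ - h₁)
        ≡⟨ sym (+-identityʳ _) ⟩
      (w₁ - h₁) + (w₁ - h₁) + 0ℚ
        ≡⟨ cong ((w₁ - h₁) + (w₁ - h₁) +_) (sym (trans (cong (_- (w₁ + w₂)) sizes) (+-inverseʳ (w₁ + w₂)))) ⟩
      (w₁ - h₁) + (w₁ - h₁) + ((h₁ + h₂) - (w₁ + w₂))
        ≡⟨ rearrange h₁ h₂ w₁ w₂ a b c d ⟩
      signed + twice-c - twice-b
        ≤⟨ p-r≤p (signed + twice-c) (+-nonNeg 0≤h₁w₂b 0≤h₁w₂b) ⟩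
      signed + twice-c
        ≤⟨ +-monoˡ-≤ twice-c signed≤error ⟩
      error X + twice-c ∎
      where
      open ≤-Reasoning
      R₁ R₂ C₁ C₂ signed twice-b twice-c : ℚ
      R₁ = rowSum₁ X
      R₂ = rowSum₂ X
      C₁ = colSum₁ X
      C₂ = colSum₂ X
      signed = (h₁ * (R₁ - 1ℚ) + h₂ * - (R₂ - 1ℚ)) + (w₁ * - (C₁ - 1ℚ) + w₂ * (C₂ - 1ℚ))
      twice-b = h₁ * w₂ * b + h₁ * w₂ * b
      twice-c = w₁ * h₂ * c + w₁ * h₂ * c
      0≤h₁w₂b : 0ℚ ≤ h₁ * w₂ * b
      0≤h₁w₂b = *-nonNeg (*-nonNeg 0≤h₁ 0≤w₂) 0≤b
      signed≤error : signed ≤ error X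
      signed≤error = +-mono-≤ (+-mono-≤ (w*p≤w*∣p∣ (R₁ - 1ℚ) 0≤h₁) (w*-p≤w*∣p∣ (R₂ - 1ℚ) 0≤h₂))
                              (+-mono-≤ (w*-p≤w*∣p∣ (C₁ - 1ℚ) 0≤w₁) (w*p≤w*∣p∣ (C₂ - 1ℚ) 0≤w₂))
      rearrange : ∀ h₁ h₂ w₁ w₂ a b c d →
        (w₁ - h₁) + (w₁ - h₁) + ((h₁ + h₂) - (w₁ + w₂))
          ≡ (h₁ * ((w₁ * a + w₂ * b) - 1ℚ) + h₂ * - ((w₁ * c + w₂ * d) - 1ℚ))
            + (w₁ * - ((h₁ * a + h₂ * c) - 1ℚ) + w₂ * ((h₁ * b + h₂ * d) - 1ℚ))
            + (w₁ * h₂ * c + w₁ * h₂ * c) - (h₁ * w₂ * b + h₁ * w₂ * b)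
      rearrange = solve-∀ ℚ-ring

module Transposed (h₁ h₂ w₁ w₂ : ℚ) where
  private
    module W = Weighted h₁ h₂ w₁ w₂
    module Wᵀ = Weighted w₁ w₂ h₁ h₂

  error-transpose : ∀ X → W.error X ≡ Wᵀ.error (transpose X)
  error-transpose X = +-comm
    (h₁ * ∣ W.rowSum₁ X - 1ℚ ∣ + h₂ * ∣ W.rowSum₂ X - 1ℚ ∣)
    (w₁ * ∣ W.colSum₁ X - 1ℚ ∣ + w₂ * ∣ W.colSum₂ X - 1ℚ ∣)

  error-colsBalanced : 0ℚ ≤ h₁ → 0ℚ ≤ h₂ → 0ℚ ≤ w₁ → 0ℚ ≤ w₂ → h₁ + h₂ ≡ w₁ + w₂ →
    ∀ X → W.ColsBalanced X → W.error X ≡ h₁ * ∣ W.rowSum₁ X - 1ℚ ∣ + h₁ * ∣ W.rowSum₁ X - 1ℚ ∣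
  error-colsBalanced 0≤h₁ 0≤h₂ 0≤w₁ 0≤w₂ sizes X cols =
    trans (error-transpose X) (Wᵀ.error-rowsBalanced 0≤w₁ 0≤w₂ 0≤h₁ 0≤h₂ (sym sizes) (transpose X) cols)

-- One normalisation step

record Regular (μ : ℚ) (X : Block) : Set where
  field
    0≤a₁₂   : 0ℚ ≤ a₁₂ X
    0≤a₂₁   : 0ℚ ≤ a₂₁ X
    a₁₂≤a₁₁ : a₁₂ X ≤ a₁₁ X
    a₂₁≤a₁₁ : a₂₁ X ≤ a₁₁ X
    a₁₂≤a₂₂ : a₁₂ X ≤ a₂₂ X
    a₂₁≤a₂₂ : a₂₁ X ≤ a₂₂ X
    det     : a₁₂ X * a₂₁ X ≤ (1ℚ - μ) * (a₁₁ X * a₂₂ X)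

Regular-transpose : ∀ {μ X} → Regular μ X → Regular μ (transpose X)
Regular-transpose {μ} {block a b c d} reg = record
  { 0≤a₁₂ = 0≤a₂₁ ; 0≤a₂₁ = 0≤a₁₂
  ; a₁₂≤a₁₁ = a₂₁≤a₁₁ ; a₂₁≤a₁₁ = a₁₂≤a₁₁
  ; a₁₂≤a₂₂ = a₂₁≤a₂₂ ; a₂₁≤a₂₂ = a₁₂≤a₂₂
  ; det = subst (_≤ (1ℚ - μ) * (a * d)) (*-comm b c) det
  }
  where open Regular reg

record Admissible (μ n h₁ h₂ w₁ w₂ : ℚ) : Set where
  field
    0<μ     : 0ℚ < μ
    0≤n     : 0ℚ ≤ n
    heights : h₁ + h₂ ≡ n
    widths  : w₁ + w₂ ≡ n
    μn≤h₁   : μ * n ≤ h₁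
    μn≤h₂   : μ * n ≤ h₂
    μn≤w₁   : μ * n ≤ w₁
    μn≤w₂   : μ * n ≤ w₂

  0≤μ : 0ℚ ≤ μ
  0≤μ = <⇒≤ 0<μ

  0≤μn : 0ℚ ≤ μ * n
  0≤μn = *-nonNeg 0≤μ 0≤n

  0≤h₁ : 0ℚ ≤ h₁
  0≤h₁ = ≤-trans 0≤μn μn≤h₁
  0≤h₂ : 0ℚ ≤ h₂
  0≤h₂ = ≤-trans 0≤μn μn≤h₂
  0≤w₁ : 0ℚ ≤ w₁
  0≤w₁ = ≤-trans 0≤μn μn≤w₁
  0≤w₂ : 0ℚ ≤ w₂
  0≤w₂ = ≤-trans 0≤μn μn≤w₂

  sizes : h₁ + h₂ ≡ w₁ + w₂
  sizes = trans heights (sym widths)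

Admissible-transpose : ∀ {μ n h₁ h₂ w₁ w₂} → Admissible μ n h₁ h₂ w₁ w₂ → Admissible μ n w₁ w₂ h₁ h₂
Admissible-transpose adm = record
  { 0<μ = 0<μ ; 0≤n = 0≤n ; heights = widths ; widths = heights
  ; μn≤h₁ = μn≤w₁ ; μn≤h₂ = μn≤w₂ ; μn≤w₁ = μn≤h₁ ; μn≤w₂ = μn≤h₂ }
  where open Admissible adm

record SlowStep (μ : ℚ) (error : Block → ℚ) (X Y : Block) : Set where
  field
    regular     : Regular μ Y
    error-decay : μ * μ * μ * error X ≤ error Y
    a₁₂-growth  : μ * a₁₂ Y ≤ a₁₂ X
    a₂₁-growth  : μ * a₂₁ Y ≤ a₂₁ X

module ColumnStep {μ n h₁ h₂ w₁ w₂ : ℚ} (adm : Admissible μ n h₁ h₂ w₁ w₂)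
  {a b c d : ℚ} (reg : Regular μ (block a b c d))
  (row₁ : w₁ * a + w₂ * b ≡ 1ℚ) (row₂ : w₁ * c + w₂ * d ≡ 1ℚ) where

  open Admissible adm
  open Regular reg
  open Weighted h₁ h₂ w₁ w₂

  0≤a : 0ℚ ≤ a
  0≤a = ≤-trans 0≤a₁₂ a₁₂≤a₁₁

  0≤d : 0ℚ ≤ d
  0≤d = ≤-trans 0≤a₁₂ a₁₂≤a₂₂

  1≤n*a : 1ℚ ≤ n * a
  1≤n*a = ≤-by-difference (w₂ * (a - b)) (begin
    n * a - 1ℚ                         ≡⟨ cong₂ (λ m r → m * a - r) (sym widths) (sym row₁) ⟩
    (w₁ + w₂) * a - (w₁ * a + w₂ * b)  ≡⟨ solve (w₁ ∷ w₂ ∷ a ∷ b ∷ []) ℚ-ring ⟩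
    w₂ * (a - b)                       ∎)
    (*-nonNeg 0≤w₂ (p≤q⇒0≤q-p a₁₂≤a₁₁))
    where open ≡-Reasoning

  1≤n*d : 1ℚ ≤ n * d
  1≤n*d = ≤-by-difference (w₁ * (d - c)) (begin
    n * d - 1ℚ                         ≡⟨ cong₂ (λ m r → m * d - r) (sym widths) (sym row₂) ⟩
    (w₁ + w₂) * d - (w₁ * c + w₂ * d)  ≡⟨ solve (w₁ ∷ w₂ ∷ c ∷ d ∷ []) ℚ-ring ⟩
    w₁ * (d - c)                       ∎)
    (*-nonNeg 0≤w₁ (p≤q⇒0≤q-p a₂₁≤a₂₂))
    where open ≡-Reasoning

  μ≤colSum₁ : μ ≤ h₁ * a + h₂ * c
  μ≤colSum₁ = ≤-by-difference ((h₁ - μ * n) * a + μ * (n * a - 1ℚ) + h₂ * c)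
    (solve (μ ∷ n ∷ h₁ ∷ h₂ ∷ a ∷ c ∷ []) ℚ-ring)
    (+-nonNeg (+-nonNeg (*-nonNeg (p≤q⇒0≤q-p μn≤h₁) 0≤a) (*-nonNeg 0≤μ (p≤q⇒0≤q-p 1≤n*a)))
              (*-nonNeg 0≤h₂ 0≤a₂₁))

  μ≤colSum₂ : μ ≤ h₁ * b + h₂ * d
  μ≤colSum₂ = ≤-by-difference (h₁ * b + (h₂ - μ * n) * d + μ * (n * d - 1ℚ))
    (solve (μ ∷ n ∷ h₁ ∷ h₂ ∷ b ∷ d ∷ []) ℚ-ring)
    (+-nonNeg (+-nonNeg (*-nonNeg 0≤h₁ 0≤a₁₂) (*-nonNeg (p≤q⇒0≤q-p μn≤h₂) 0≤d))
              (*-nonNeg 0≤μ (p≤q⇒0≤q-p 1≤n*d)))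

  colSum₁≤n*a : h₁ * a + h₂ * c ≤ n * a
  colSum₁≤n*a = ≤-by-difference (h₂ * (a - c)) (begin
    n * a - (h₁ * a + h₂ * c)          ≡⟨ cong (λ m → m * a - (h₁ * a + h₂ * c)) (sym heights) ⟩
    (h₁ + h₂) * a - (h₁ * a + h₂ * c)  ≡⟨ solve (h₁ ∷ h₂ ∷ a ∷ c ∷ []) ℚ-ring ⟩
    h₂ * (a - c)                       ∎)
    (*-nonNeg 0≤h₂ (p≤q⇒0≤q-p a₂₁≤a₁₁))
    where open ≡-Reasoning

  colSum₂≤n*d : h₁ * b + h₂ * d ≤ n * d
  colSum₂≤n*d = ≤-by-difference (h₁ * (d - b)) (begin
    n * d - (h₁ * b + h₂ * d)          ≡⟨ cong (λ m → m * d - (h₁ * b + h₂ * d)) (sym heights) ⟩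
    (h₁ + h₂) * d - (h₁ * b + h₂ * d)  ≡⟨ solve (h₁ ∷ h₂ ∷ b ∷ d ∷ []) ℚ-ring ⟩
    h₁ * (d - b)                       ∎)
    (*-nonNeg 0≤h₁ (p≤q⇒0≤q-p a₁₂≤a₂₂))
    where open ≡-Reasoning

  μad≤det : μ * (a * d) ≤ a * d - b * c
  μad≤det = ≤-by-difference ((1ℚ - μ) * (a * d) - b * c)
    (solve (μ ∷ a ∷ b ∷ c ∷ d ∷ []) ℚ-ring) (p≤q⇒0≤q-p det)

  0≤det : 0ℚ ≤ a * d - b * c
  0≤det = ≤-trans (*-nonNeg 0≤μ (*-nonNeg 0≤a 0≤d)) μad≤det

  0<colSum₁ : 0ℚ < h₁ * a + h₂ * c
  0<colSum₁ = <-≤-trans 0<μ μ≤colSum₁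

  0<colSum₂ : 0ℚ < h₁ * b + h₂ * d
  0<colSum₂ = <-≤-trans 0<μ μ≤colSum₂

  -- The normalised entries and column sums as variables, so that the ring
  -- solver can treat them as atoms.
  module Rescaled {C₁ C₂ a′ b′ c′ d′ : ℚ}
    (C₁-def : h₁ * a + h₂ * c ≡ C₁) (C₂-def : h₁ * b + h₂ * d ≡ C₂)
    (a′C₁ : a′ * C₁ ≡ a) (b′C₂ : b′ * C₂ ≡ b) (c′C₁ : c′ * C₁ ≡ c) (d′C₂ : d′ * C₂ ≡ d) where

    μ≤C₁ : μ ≤ C₁
    μ≤C₁ = subst (μ ≤_) C₁-def μ≤colSum₁

    μ≤C₂ : μ ≤ C₂
    μ≤C₂ = subst (μ ≤_) C₂-def μ≤colSum₂

    0<C₁ : 0ℚ < C₁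
    0<C₁ = <-≤-trans 0<μ μ≤C₁

    0<C₂ : 0ℚ < C₂
    0<C₂ = <-≤-trans 0<μ μ≤C₂

    0<C₁C₂ : 0ℚ < C₁ * C₂
    0<C₁C₂ = *-pos 0<C₁ 0<C₂

    col₁ : h₁ * a′ + h₂ * c′ ≡ 1ℚ
    col₁ = *-cancelʳ-≡-0< 0<C₁ (begin
      (h₁ * a′ + h₂ * c′) * C₁         ≡⟨ solve (h₁ ∷ h₂ ∷ a′ ∷ c′ ∷ C₁ ∷ []) ℚ-ring ⟩
      h₁ * (a′ * C₁) + h₂ * (c′ * C₁)  ≡⟨ cong₂ (λ x y → h₁ * x + h₂ * y) a′C₁ c′C₁ ⟩
      h₁ * a + h₂ * c                  ≡⟨ C₁-def ⟩
      C₁                               ≡⟨ sym (*-identityˡ C₁) ⟩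
      1ℚ * C₁                          ∎)
      where open ≡-Reasoning

    col₂ : h₁ * b′ + h₂ * d′ ≡ 1ℚ
    col₂ = *-cancelʳ-≡-0< 0<C₂ (begin
      (h₁ * b′ + h₂ * d′) * C₂         ≡⟨ solve (h₁ ∷ h₂ ∷ b′ ∷ d′ ∷ C₂ ∷ []) ℚ-ring ⟩
      h₁ * (b′ * C₂) + h₂ * (d′ * C₂)  ≡⟨ cong₂ (λ x y → h₁ * x + h₂ * y) b′C₂ d′C₂ ⟩
      h₁ * b + h₂ * d                  ≡⟨ C₂-def ⟩
      C₂                               ≡⟨ sym (*-identityˡ C₂) ⟩
      1ℚ * C₂                          ∎)
      where open ≡-Reasoning

    gap-a′b′ : (a′ - b′) * (C₁ * C₂) ≡ h₂ * (a * d - b * c)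
    gap-a′b′ = begin
      (a′ - b′) * (C₁ * C₂)                          ≡⟨ solve (a′ ∷ b′ ∷ C₁ ∷ C₂ ∷ []) ℚ-ring ⟩
      (a′ * C₁) * C₂ - (b′ * C₂) * C₁                ≡⟨ cong₂ (λ x y → x * C₂ - y * C₁) a′C₁ b′C₂ ⟩
      a * C₂ - b * C₁                                ≡⟨ cong₂ (λ x y → a * x - b * y) (sym C₂-def) (sym C₁-def) ⟩
      a * (h₁ * b + h₂ * d) - b * (h₁ * a + h₂ * c)  ≡⟨ solve (h₁ ∷ h₂ ∷ a ∷ b ∷ c ∷ d ∷ []) ℚ-ring ⟩
      h₂ * (a * d - b * c)                           ∎
      where open ≡-Reasoning

    gap-d′c′ : (d′ - c′) * (C₁ * C₂) ≡ h₁ * (a * d - b * c)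
    gap-d′c′ = begin
      (d′ - c′) * (C₁ * C₂)                          ≡⟨ solve (d′ ∷ c′ ∷ C₁ ∷ C₂ ∷ []) ℚ-ring ⟩
      (d′ * C₂) * C₁ - (c′ * C₁) * C₂                ≡⟨ cong₂ (λ x y → x * C₁ - y * C₂) d′C₂ c′C₁ ⟩
      d * C₁ - c * C₂                                ≡⟨ cong₂ (λ x y → d * x - c * y) (sym C₁-def) (sym C₂-def) ⟩
      d * (h₁ * a + h₂ * c) - c * (h₁ * b + h₂ * d)  ≡⟨ solve (h₁ ∷ h₂ ∷ a ∷ b ∷ c ∷ d ∷ []) ℚ-ring ⟩
      h₁ * (a * d - b * c)                           ∎
      where open ≡-Reasoning

    regular : Regular μ (block a′ b′ c′ d′)
    regular = record
      { 0≤a₁₂ = 0≤p*r⇒0≤p 0<C₂ (subst (0ℚ ≤_) (sym b′C₂) 0≤a₁₂)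
      ; 0≤a₂₁ = 0≤p*r⇒0≤p 0<C₁ (subst (0ℚ ≤_) (sym c′C₁) 0≤a₂₁)
      ; a₁₂≤a₁₁ = ≤-by-difference (a′ - b′) refl (0≤p*r⇒0≤p 0<C₁C₂ (subst (0ℚ ≤_) (sym gap-a′b′) (*-nonNeg 0≤h₂ 0≤det)))
      ; a₂₁≤a₁₁ = *-cancelʳ-≤-rescaled 0<C₁ c′C₁ a′C₁ a₂₁≤a₁₁
      ; a₁₂≤a₂₂ = *-cancelʳ-≤-rescaled 0<C₂ b′C₂ d′C₂ a₁₂≤a₂₂
      ; a₂₁≤a₂₂ = ≤-by-difference (d′ - c′) refl (0≤p*r⇒0≤p 0<C₁C₂ (subst (0ℚ ≤_) (sym gap-d′c′) (*-nonNeg 0≤h₁ 0≤det)))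
      ; det = *-cancelʳ-≤-0< 0<C₁C₂ (begin
          b′ * c′ * (C₁ * C₂)                     ≡⟨ solve (b′ ∷ c′ ∷ C₁ ∷ C₂ ∷ []) ℚ-ring ⟩
          (b′ * C₂) * (c′ * C₁)                   ≡⟨ cong₂ _*_ b′C₂ c′C₁ ⟩
          b * c                                   ≤⟨ det ⟩
          (1ℚ - μ) * (a * d)                      ≡⟨ cong₂ (λ x y → (1ℚ - μ) * (x * y)) (sym a′C₁) (sym d′C₂) ⟩
          (1ℚ - μ) * ((a′ * C₁) * (d′ * C₂))      ≡⟨ solve (μ ∷ a′ ∷ d′ ∷ C₁ ∷ C₂ ∷ []) ℚ-ring ⟩
          (1ℚ - μ) * (a′ * d′) * (C₁ * C₂)        ∎)
      }
      where open ≤-Reasoning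

    μ³≤h₁*gap : μ * μ * μ ≤ h₁ * (a′ - b′)
    μ³≤h₁*gap = *-cancelʳ-≤-0< 0<C₁C₂ (begin
      μ * μ * μ * (C₁ * C₂)
        ≤⟨ *-monoˡ-≤-0≤ 0≤μ³ (*-mono-≤-0≤ (<⇒≤ 0<C₁) (<⇒≤ 0<C₂)
             (subst (_≤ n * a) C₁-def colSum₁≤n*a) (subst (_≤ n * d) C₂-def colSum₂≤n*d)) ⟩
      μ * μ * μ * ((n * a) * (n * d))
        ≡⟨ solve (μ ∷ n ∷ a ∷ d ∷ []) ℚ-ring ⟩
      (μ * n) * ((μ * n) * (μ * (a * d)))
        ≤⟨ *-mono-≤-0≤ 0≤μn (*-nonNeg 0≤μn (*-nonNeg 0≤μ (*-nonNeg 0≤a 0≤d))) μn≤h₁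
             (*-mono-≤-0≤ 0≤μn (*-nonNeg 0≤μ (*-nonNeg 0≤a 0≤d)) μn≤h₂ μad≤det) ⟩
      h₁ * (h₂ * (a * d - b * c))
        ≡⟨ cong (h₁ *_) (sym gap-a′b′) ⟩
      h₁ * ((a′ - b′) * (C₁ * C₂))
        ≡⟨ sym (*-assoc h₁ (a′ - b′) (C₁ * C₂)) ⟩
      h₁ * (a′ - b′) * (C₁ * C₂) ∎)
      where
      open ≤-Reasoning
      0≤μ³ : 0ℚ ≤ μ * μ * μ
      0≤μ³ = *-nonNeg (*-nonNeg 0≤μ 0≤μ) 0≤μ

    μb′≤b : μ * b′ ≤ b
    μb′≤b = ≤-trans (*-monoʳ-≤-0≤ (Regular.0≤a₁₂ regular) μ≤C₂) (≤-reflexive (trans (*-comm C₂ b′) b′C₂))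

    μc′≤c : μ * c′ ≤ c
    μc′≤c = ≤-trans (*-monoʳ-≤-0≤ (Regular.0≤a₂₁ regular) μ≤C₁) (≤-reflexive (trans (*-comm C₁ c′) c′C₁))

    row₁-deviation : (w₁ * a′ + w₂ * b′) - 1ℚ ≡ w₁ * (1ℚ - C₁) * (a′ - b′)
    row₁-deviation = begin
      (w₁ * a′ + w₂ * b′) - 1ℚ
        ≡⟨ cong (λ r → (w₁ * a′ + w₂ * b′) - r) (sym row₁) ⟩
      (w₁ * a′ + w₂ * b′) - (w₁ * a + w₂ * b)
        ≡⟨ cong₂ (λ x y → (w₁ * a′ + w₂ * b′) - (w₁ * x + w₂ * y)) (sym a′C₁) (sym b′C₂) ⟩
      (w₁ * a′ + w₂ * b′) - (w₁ * (a′ * C₁) + w₂ * (b′ * C₂))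
        ≡⟨ solve (w₁ ∷ w₂ ∷ a′ ∷ b′ ∷ C₁ ∷ C₂ ∷ []) ℚ-ring ⟩
      w₁ * a′ * (1ℚ - C₁) + b′ * ((w₁ + w₂) - (w₁ * C₁ + w₂ * C₂) + w₁ * (C₁ - 1ℚ))
        ≡⟨ cong (λ m → w₁ * a′ * (1ℚ - C₁) + b′ * ((w₁ + w₂) - m + w₁ * (C₁ - 1ℚ))) col-mass ⟩
      w₁ * a′ * (1ℚ - C₁) + b′ * ((w₁ + w₂) - (w₁ + w₂) + w₁ * (C₁ - 1ℚ))
        ≡⟨ solve (w₁ ∷ w₂ ∷ a′ ∷ b′ ∷ C₁ ∷ []) ℚ-ring ⟩
      w₁ * (1ℚ - C₁) * (a′ - b′) ∎
      where
      open ≡-Reasoning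
      col-mass : w₁ * C₁ + w₂ * C₂ ≡ w₁ + w₂
      col-mass = subst₂ (λ x y → w₁ * x + w₂ * y ≡ w₁ + w₂) C₁-def C₂-def
        (colSums-balance sizes (block a b c d) (row₁ , row₂))

    error-decay : μ * μ * μ * error (block a b c d) ≤ error (block a′ b′ c′ d′)
    error-decay = begin
      μ * μ * μ * error (block a b c d)
        ≡⟨ cong (μ * μ * μ *_) error-before ⟩
      μ * μ * μ * (e + e)
        ≤⟨ *-monoʳ-≤-0≤ (+-nonNeg 0≤e 0≤e) μ³≤h₁*gap ⟩
      h₁ * (a′ - b′) * (e + e)
        ≡⟨ sym (regroup h₁ (a′ - b′) e) ⟩
      h₁ * (e * (a′ - b′)) + h₁ * (e * (a′ - b′))
        ≡⟨ cong (λ x → h₁ * x + h₁ * x) (sym ∣row₁-deviation∣) ⟩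
      h₁ * ∣ R₁′ - 1ℚ ∣ + h₁ * ∣ R₁′ - 1ℚ ∣
        ≡⟨ sym (Transposed.error-colsBalanced h₁ h₂ w₁ w₂ 0≤h₁ 0≤h₂ 0≤w₁ 0≤w₂ sizes (block a′ b′ c′ d′) (col₁ , col₂)) ⟩
      error (block a′ b′ c′ d′) ∎
      where
      open ≤-Reasoning
      R₁′ e : ℚ
      R₁′ = w₁ * a′ + w₂ * b′
      e = w₁ * ∣ C₁ - 1ℚ ∣
      0≤e : 0ℚ ≤ e
      0≤e = *-nonNeg 0≤w₁ (0≤∣p∣ (C₁ - 1ℚ))
      error-before : error (block a b c d) ≡ e + e
      error-before = trans (error-rowsBalanced 0≤h₁ 0≤h₂ 0≤w₁ 0≤w₂ sizes (block a b c d) (row₁ , row₂))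
                           (cong (λ C → w₁ * ∣ C - 1ℚ ∣ + w₁ * ∣ C - 1ℚ ∣) C₁-def)
      ∣1-C₁∣ : ∣ 1ℚ - C₁ ∣ ≡ ∣ C₁ - 1ℚ ∣
      ∣1-C₁∣ = trans (cong ∣_∣ 1-C₁≡-[C₁-1]) (∣-p∣≡∣p∣ (C₁ - 1ℚ))
        where
        1-C₁≡-[C₁-1] : 1ℚ - C₁ ≡ - (C₁ - 1ℚ)
        1-C₁≡-[C₁-1] = solve (C₁ ∷ []) ℚ-ring
      ∣row₁-deviation∣ : ∣ R₁′ - 1ℚ ∣ ≡ e * (a′ - b′)
      ∣row₁-deviation∣ = begin-equality
        ∣ R₁′ - 1ℚ ∣                          ≡⟨ cong ∣_∣ row₁-deviation ⟩
        ∣ w₁ * (1ℚ - C₁) * (a′ - b′) ∣        ≡⟨ ∣p*q∣≡∣p∣*∣q∣ (w₁ * (1ℚ - C₁)) (a′ - b′) ⟩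
        ∣ w₁ * (1ℚ - C₁) ∣ * ∣ a′ - b′ ∣      ≡⟨ cong₂ _*_ (∣w*p∣≡w*∣p∣ (1ℚ - C₁) 0≤w₁) (0≤p⇒∣p∣≡p (p≤q⇒0≤q-p (Regular.a₁₂≤a₁₁ regular))) ⟩
        w₁ * ∣ 1ℚ - C₁ ∣ * (a′ - b′)          ≡⟨ cong (λ x → w₁ * x * (a′ - b′)) ∣1-C₁∣ ⟩
        e * (a′ - b′)                         ∎
      regroup : ∀ h g e → h * (e * g) + h * (e * g) ≡ h * g * (e + e)
      regroup = solve-∀ ℚ-ring

  private
    module Normalised = Rescaled
      {a′ = a ÷₀ (h₁ * a + h₂ * c)} {b′ = b ÷₀ (h₁ * b + h₂ * d)}
      {c′ = c ÷₀ (h₁ * a + h₂ * c)} {d′ = d ÷₀ (h₁ * b + h₂ * d)} refl refl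
      (x÷₀y*y≡x a 0<colSum₁) (x÷₀y*y≡x b 0<colSum₂) (x÷₀y*y≡x c 0<colSum₁) (x÷₀y*y≡x d 0<colSum₂)

  colStep-balanced : ColsBalanced (colStep (block a b c d))
  colStep-balanced = Normalised.col₁ , Normalised.col₂

  colStep-slow : SlowStep μ error (block a b c d) (colStep (block a b c d))
  colStep-slow = record
    { regular = Normalised.regular
    ; error-decay = Normalised.error-decay
    ; a₁₂-growth = Normalised.μb′≤b
    ; a₂₁-growth = Normalised.μc′≤c
    }

-- The SK iteration on block patterns

module _ {μ n h₁ h₂ w₁ w₂ : ℚ} (adm : Admissible μ n h₁ h₂ w₁ w₂) where
  open Weighted h₁ h₂ w₁ w₂

  colStep-properties : ∀ {X} → Regular μ X → RowsBalanced X →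
    ColsBalanced (colStep X) × SlowStep μ error X (colStep X)
  colStep-properties {block a b c d} reg (row₁ , row₂) = colStep-balanced , colStep-slow
    where open ColumnStep adm reg row₁ row₂

module _ {μ n h₁ h₂ w₁ w₂ : ℚ} (adm : Admissible μ n h₁ h₂ w₁ w₂) where
  open Weighted h₁ h₂ w₁ w₂

  -- A row step is a column step of the transposed pattern.
  rowStep-properties : ∀ {X} → Regular μ X → ColsBalanced X →
    RowsBalanced (rowStep X) × SlowStep μ error X (rowStep X)
  rowStep-properties {X} reg cols = proj₁ stepᵀ , record
    { regular     = Regular-transpose (SlowStep.regular boundsᵀ)
    ; error-decay = subst₂ (λ e e′ → μ * μ * μ * e ≤ e′) (sym (error-transpose X)) (sym (error-transpose (rowStep X)))
                      (SlowStep.error-decay boundsᵀ)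
    ; a₁₂-growth  = SlowStep.a₂₁-growth boundsᵀ
    ; a₂₁-growth  = SlowStep.a₁₂-growth boundsᵀ
    }
    where
    module Wᵀ = Weighted w₁ w₂ h₁ h₂
    open Transposed h₁ h₂ w₁ w₂ using (error-transpose)
    Yᵀ : Block
    Yᵀ = Wᵀ.colStep (transpose X)
    stepᵀ : Wᵀ.ColsBalanced Yᵀ × SlowStep μ Wᵀ.error (transpose X) Yᵀ
    stepᵀ = colStep-properties (Admissible-transpose adm) (Regular-transpose reg) cols
    boundsᵀ : SlowStep μ Wᵀ.error (transpose X) Yᵀ
    boundsᵀ = proj₂ stepᵀ

module Iteration {μ n h₁ h₂ w₁ w₂ : ℚ} (adm : Admissible μ n h₁ h₂ w₁ w₂) where
  open Admissible adm using (0<μ; 0≤μ)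
  open Weighted h₁ h₂ w₁ w₂

  Balanced : Bool → Block → Set
  Balanced false = RowsBalanced
  Balanced true  = ColsBalanced

  nextSK-step : ∀ k {Y} → Regular μ Y → Balanced (isOdd k) Y →
    Balanced (isOdd (suc k)) (nextSK k Y) × SlowStep μ error Y (nextSK k Y)
  nextSK-step k reg balanced with isOdd k
  ... | false = colStep-properties adm reg balanced
  ... | true  = rowStep-properties adm reg balanced

  record Invariant (X : Block) (k : ℕ) (Y : Block) : Set where
    field
      regular     : Regular μ Y
      balanced    : Balanced (isOdd k) Y
      error-decay : (μ * μ * μ) ^ℚ k * error X ≤ error Y
      a₂₁-growth  : μ ^ℚ k * a₂₁ Y ≤ a₂₁ X

  invariant : ∀ {X} → Regular μ X → RowsBalanced X → ∀ k → Invariant X k (blockSK X k)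
  invariant {X} reg rows zero = subst (Invariant X 0) (sym (rowStep-balanced X rows)) (record
    { regular     = reg
    ; balanced    = rows
    ; error-decay = ≤-reflexive (*-identityˡ (error X))
    ; a₂₁-growth  = ≤-reflexive (*-identityˡ (a₂₁ X))
    })
  invariant {X} reg rows (suc k) = record
    { regular     = SlowStep.regular bounds
    ; balanced    = proj₁ step
    ; error-decay = begin
        ρ * ρ ^ℚ k * error X    ≡⟨ *-assoc ρ (ρ ^ℚ k) (error X) ⟩
        ρ * (ρ ^ℚ k * error X)  ≤⟨ *-monoˡ-≤-0≤ 0≤ρ error-decay ⟩
        ρ * error Y             ≤⟨ SlowStep.error-decay bounds ⟩
        error (nextSK k Y)      ∎
    ; a₂₁-growth = begin
        μ * μ ^ℚ k * a₂₁ (nextSK k Y)    ≡⟨ swap μ (μ ^ℚ k) (a₂₁ (nextSK k Y)) ⟩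
        μ ^ℚ k * (μ * a₂₁ (nextSK k Y))  ≤⟨ *-monoˡ-≤-0≤ (<⇒≤ (^ℚ-pos k 0<μ)) (SlowStep.a₂₁-growth bounds) ⟩
        μ ^ℚ k * a₂₁ Y                   ≤⟨ a₂₁-growth ⟩
        a₂₁ X                            ∎
    }
    where
    open ≤-Reasoning
    Y : Block
    Y = blockSK X k
    ρ : ℚ
    ρ = μ * μ * μ
    0≤ρ : 0ℚ ≤ ρ
    0≤ρ = *-nonNeg (*-nonNeg 0≤μ 0≤μ) 0≤μ
    open Invariant (invariant reg rows k)
    step : Balanced (isOdd (suc k)) (nextSK k Y) × SlowStep μ error Y (nextSK k Y)
    step = nextSK-step k regular balanced
    bounds : SlowStep μ error Y (nextSK k Y)
    bounds = proj₂ step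
    swap : ∀ x y z → x * y * z ≡ y * (x * z)
    swap = solve-∀ ℚ-ring

-- Block matrices

entry : Bool → Bool → Block → ℚ
entry p q X = if p then (if q then a₁₁ X else a₁₂ X) else (if q then a₂₁ X else a₂₂ X)

module BlockMatrix (n s t : ℕ) (s≤n : s ℕ.≤ n) (t≤n : t ℕ.≤ n) where
  open Weighted (ℕtoℚ t) (ℕtoℚ n - ℕtoℚ t) (ℕtoℚ s) (ℕtoℚ n - ℕtoℚ s)

  toMatrix : Block → Mat n
  toMatrix X = blockMatrix n s t (a₁₁ X) (a₁₂ X) (a₂₁ X) (a₂₂ X)

  _≈_ : Mat n → Mat n → Set
  M ≈ M′ = ∀ i j → M i j ≡ M′ i j

  inTop : Fin n → Bool
  inTop i = toℕ i ℕ.<ᵇ t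

  inLeft : Fin n → Bool
  inLeft j = toℕ j ℕ.<ᵇ s

  rowSum-toMatrix : ∀ X i → rowSum (toMatrix X) i ≡ (if inTop i then rowSum₁ X else rowSum₂ X)
  rowSum-toMatrix X i with inTop i
  ... | true  = ∑-threshold s≤n (a₁₁ X) (a₁₂ X)
  ... | false = ∑-threshold s≤n (a₂₁ X) (a₂₂ X)

  colSum-toMatrix : ∀ X j → colSum (toMatrix X) j ≡ (if inLeft j then colSum₁ X else colSum₂ X)
  colSum-toMatrix X j with inLeft j
  ... | true  = ∑-threshold t≤n (a₁₁ X) (a₂₁ X)
  ... | false = ∑-threshold t≤n (a₁₂ X) (a₂₂ X)

  rowStep-entry : ∀ p q X → entry p q X ÷₀ (if p then rowSum₁ X else rowSum₂ X) ≡ entry p q (rowStep X)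
  rowStep-entry true  true  X = refl
  rowStep-entry true  false X = refl
  rowStep-entry false true  X = refl
  rowStep-entry false false X = refl

  colStep-entry : ∀ p q X → entry p q X ÷₀ (if q then colSum₁ X else colSum₂ X) ≡ entry p q (colStep X)
  colStep-entry true  true  X = refl
  colStep-entry true  false X = refl
  colStep-entry false true  X = refl
  colStep-entry false false X = refl

  rowNormalize-toMatrix : ∀ {M} X → M ≈ toMatrix X → rowNormalize M ≈ toMatrix (rowStep X)
  rowNormalize-toMatrix X M≈X i j = trans
    (cong₂ _÷₀_ (M≈X i j) (trans (∑-cong (M≈X i)) (rowSum-toMatrix X i)))
    (rowStep-entry (inTop i) (inLeft j) X)

  colNormalize-toMatrix : ∀ {M} X → M ≈ toMatrix X → colNormalize M ≈ toMatrix (colStep X)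
  colNormalize-toMatrix X M≈X i j = trans
    (cong₂ _÷₀_ (M≈X i j) (trans (∑-cong (λ i′ → M≈X i′ j)) (colSum-toMatrix X j)))
    (colStep-entry (inTop i) (inLeft j) X)

  SKstep-toMatrix : ∀ (p : Bool) {M} X → M ≈ toMatrix X →
    (if p then colNormalize M else rowNormalize M) ≈ toMatrix (if p then colStep X else rowStep X)
  SKstep-toMatrix true  = colNormalize-toMatrix
  SKstep-toMatrix false = rowNormalize-toMatrix

  SK-toMatrix : ∀ X k → SK (toMatrix X) k ≈ toMatrix (blockSK X k)
  SK-toMatrix X zero    = rowNormalize-toMatrix X (λ i j → refl)
  SK-toMatrix X (suc k) = SKstep-toMatrix (isOdd (suc k)) (blockSK X k) (SK-toMatrix X k)

  rowErrors-toMatrix : ∀ {M} X → M ≈ toMatrix X →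
    ∑ (λ i → ∣ rowSum M i - 1ℚ ∣) ≡ ℕtoℚ t * ∣ rowSum₁ X - 1ℚ ∣ + (ℕtoℚ n - ℕtoℚ t) * ∣ rowSum₂ X - 1ℚ ∣
  rowErrors-toMatrix X M≈X = trans
    (∑-cong (λ i → trans (cong (λ r → ∣ r - 1ℚ ∣) (trans (∑-cong (M≈X i)) (rowSum-toMatrix X i)))
                         (if-float (λ r → ∣ r - 1ℚ ∣) (inTop i))))
    (∑-threshold t≤n ∣ rowSum₁ X - 1ℚ ∣ ∣ rowSum₂ X - 1ℚ ∣)

  colErrors-toMatrix : ∀ {M} X → M ≈ toMatrix X →
    ∑ (λ j → ∣ colSum M j - 1ℚ ∣) ≡ ℕtoℚ s * ∣ colSum₁ X - 1ℚ ∣ + (ℕtoℚ n - ℕtoℚ s) * ∣ colSum₂ X - 1ℚ ∣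
  colErrors-toMatrix X M≈X = trans
    (∑-cong (λ j → trans (cong (λ r → ∣ r - 1ℚ ∣) (trans (∑-cong (λ i → M≈X i j)) (colSum-toMatrix X j)))
                         (if-float (λ r → ∣ r - 1ℚ ∣) (inLeft j))))
    (∑-threshold s≤n ∣ colSum₁ X - 1ℚ ∣ ∣ colSum₂ X - 1ℚ ∣)

  marginalError-SK : ∀ X K → marginalError (SK (toMatrix X) K) ≡ error (blockSK X K)
  marginalError-SK X K =
    cong₂ _+_ (rowErrors-toMatrix (blockSK X K) (SK-toMatrix X K)) (colErrors-toMatrix (blockSK X K) (SK-toMatrix X K))

-- The initial pattern

module InitialBlock {N S T μ : ℚ} (0<T : 0ℚ < T) (T<S : T < S) (S<N : S < N)
  (μ<1 : μ < 1ℚ) (μ-small : μ * (ℕtoℚ 6 * N + ℕtoℚ 5 * (N - T)) ≤ ℕtoℚ 5 * (N - T))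
  {a b c d : ℚ} (0<a : 0ℚ < a) (0<b : 0ℚ < b) (0<c : 0ℚ < c) (0<d : 0ℚ < d)
  (row₁ : S * a + (N - S) * b ≡ 1ℚ) (row₂ : S * c + (N - S) * d ≡ 1ℚ)
  (col₁<1 : T * a + (N - T) * c < 1ℚ) (1<col₂ : 1ℚ < T * b + (N - T) * d)
  (b-small : b * (ℕtoℚ 6 * N * N + ℕtoℚ 5 * S * (N - T)) < ℕtoℚ 6 * N)
  where

  0<S : 0ℚ < S
  0<S = <-trans 0<T T<S

  0<N : 0ℚ < N
  0<N = <-trans 0<S S<N

  0<N-S : 0ℚ < N - S
  0<N-S = p<q⇒0<q-p S<N

  0<N-T : 0ℚ < N - T
  0<N-T = p<q⇒0<q-p (<-trans T<S S<N)

  0<6N : 0ℚ < ℕtoℚ 6 * N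
  0<6N = *-pos (positive⁻¹ (ℕtoℚ 6)) 0<N

  N*b<1 : N * b < 1ℚ
  N*b<1 = *-cancelˡ-<-0≤ (<⇒≤ 0<6N) (begin-strict
    ℕtoℚ 6 * N * (N * b)  ≤⟨ ≤-by-difference (b * (ℕtoℚ 5 * S * (N - T))) (solve (N ∷ S ∷ T ∷ b ∷ []) ℚ-ring)
                                (*-nonNeg (<⇒≤ 0<b) (*-nonNeg (*-nonNeg (nonNegative⁻¹ (ℕtoℚ 5)) (<⇒≤ 0<S)) (<⇒≤ 0<N-T))) ⟩
    b * (ℕtoℚ 6 * N * N + ℕtoℚ 5 * S * (N - T))  <⟨ b-small ⟩
    ℕtoℚ 6 * N            ≡⟨ sym (*-identityʳ _) ⟩
    ℕtoℚ 6 * N * 1ℚ       ∎)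
    where open ≤-Reasoning

  1<N*a : 1ℚ < N * a
  1<N*a = <-by-scaled-difference ((N - S) * (1ℚ - N * b)) 0<S (begin
    S * (N * a - 1ℚ)                                           ≡⟨ solve (N ∷ S ∷ a ∷ b ∷ []) ℚ-ring ⟩
    (N - S) * (1ℚ - N * b) + N * ((S * a + (N - S) * b) - 1ℚ)  ≡⟨ x≡1⇒e+k*[x-1]≡e _ N row₁ ⟩
    (N - S) * (1ℚ - N * b)                                     ∎)
    (*-pos 0<N-S (p<q⇒0<q-p N*b<1))
    where open ≡-Reasoning

  N*c<1 : N * c < 1ℚ
  N*c<1 = <-by-scaled-difference (N * (1ℚ - (T * a + (N - T) * c)) + T * (N * a - 1ℚ)) 0<N-T
    (solve (N ∷ T ∷ a ∷ c ∷ []) ℚ-ring)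
    (+-pos-nonNeg (*-pos 0<N (p<q⇒0<q-p col₁<1)) (*-nonNeg (<⇒≤ 0<T) (<⇒≤ (p<q⇒0<q-p 1<N*a))))

  1<N*d : 1ℚ < N * d
  1<N*d = <-by-scaled-difference (N * ((T * b + (N - T) * d) - 1ℚ) + T * (1ℚ - N * b)) 0<N-T
    (solve (N ∷ T ∷ b ∷ d ∷ []) ℚ-ring)
    (+-pos-nonNeg (*-pos 0<N (p<q⇒0<q-p 1<col₂)) (*-nonNeg (<⇒≤ 0<T) (<⇒≤ (p<q⇒0<q-p N*b<1))))

  -- The entries are compared through 1/N: a and d lie above it, b and c below.
  below-1/N<above : ∀ {x y} → N * x < 1ℚ → 1ℚ < N * y → x < y
  below-1/N<above N*x<1 1<N*y = *-cancelˡ-<-0≤ (<⇒≤ 0<N) (<-trans N*x<1 1<N*y)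

  -- The bound on b is needed at full strength here: b (S + (1 − μ)(N − S)) < 1 − μ.
  b<[1-μ]a : b < (1ℚ - μ) * a
  b<[1-μ]a = <-by-scaled-difference ((1ℚ - μ) - b * (S + (1ℚ - μ) * (N - S))) 0<S (begin
    S * ((1ℚ - μ) * a - b)
      ≡⟨ solve (N ∷ S ∷ μ ∷ a ∷ b ∷ []) ℚ-ring ⟩
    ((1ℚ - μ) - b * (S + (1ℚ - μ) * (N - S))) + (1ℚ - μ) * ((S * a + (N - S) * b) - 1ℚ)
      ≡⟨ x≡1⇒e+k*[x-1]≡e _ (1ℚ - μ) row₁ ⟩
    (1ℚ - μ) - b * (S + (1ℚ - μ) * (N - S)) ∎)
    (p<q⇒0<q-p bW<1-μ)
    where
    open ≡-Reasoning
    0<W : 0ℚ < S + (1ℚ - μ) * (N - S)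
    0<W = +-pos-nonNeg 0<S (*-nonNeg (<⇒≤ (p<q⇒0<q-p μ<1)) (<⇒≤ 0<N-S))
    bW<1-μ : b * (S + (1ℚ - μ) * (N - S)) < 1ℚ - μ
    bW<1-μ = <-by-scaled-difference
      ((S + (1ℚ - μ) * (N - S)) * (ℕtoℚ 6 * N - b * (ℕtoℚ 6 * N * N + ℕtoℚ 5 * S * (N - T)))
        + S * (ℕtoℚ 5 * (N - T) - μ * (ℕtoℚ 6 * N + ℕtoℚ 5 * (N - T))))
      (+-pos (*-pos 0<6N 0<N) (*-pos (*-pos (positive⁻¹ (ℕtoℚ 5)) 0<S) 0<N-T))
      (solve (N ∷ S ∷ T ∷ μ ∷ b ∷ []) ℚ-ring)
      (+-pos-nonNeg (*-pos 0<W (p<q⇒0<q-p b-small)) (*-nonNeg (<⇒≤ 0<S) (p≤q⇒0≤q-p μ-small)))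

  initial-regular : Regular μ (block a b c d)
  initial-regular = record
    { 0≤a₁₂   = <⇒≤ 0<b
    ; 0≤a₂₁   = <⇒≤ 0<c
    ; a₁₂≤a₁₁ = <⇒≤ (below-1/N<above N*b<1 1<N*a)
    ; a₂₁≤a₁₁ = <⇒≤ (below-1/N<above N*c<1 1<N*a)
    ; a₁₂≤a₂₂ = <⇒≤ (below-1/N<above N*b<1 1<N*d)
    ; a₂₁≤a₂₂ = c≤d
    ; det     = begin
        b * c              ≤⟨ *-monoˡ-≤-0≤ (<⇒≤ 0<b) c≤d ⟩
        b * d              ≤⟨ *-monoʳ-≤-0≤ (<⇒≤ 0<d) (<⇒≤ b<[1-μ]a) ⟩
        (1ℚ - μ) * a * d   ≡⟨ *-assoc (1ℚ - μ) a d ⟩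
        (1ℚ - μ) * (a * d) ∎
    }
    where
    open ≤-Reasoning
    c≤d : c ≤ d
    c≤d = <⇒≤ (below-1/N<above N*c<1 1<N*d)

-- Counting steps

0<_≤1 : ℚ → Set
0< p ≤1 = 0ℚ < p × p ≤ 1ℚ

*-0<≤1 : ∀ {p q} → 0< p ≤1 → 0< q ≤1 → 0< p * q ≤1
*-0<≤1 {p} {q} (0<p , p≤1) (0<q , q≤1) = *-pos 0<p 0<q , (begin
  p * q   ≤⟨ *-monoˡ-≤-0≤ (<⇒≤ 0<p) q≤1 ⟩
  p * 1ℚ  ≡⟨ *-identityʳ p ⟩
  p       ≤⟨ p≤1 ⟩
  1ℚ      ∎)
  where open ≤-Reasoning

exponential-lower-bound : ∀ {C Λ σ x} K → 1ℚ ≤ C → 0< Λ ≤1 → 0< σ ≤1 →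
  Λ * σ ^ℚ K < C * x → 1ℚ ≤ x * (C ÷₀ (Λ * σ)) ^ℚ (K ℕ.+ 1)
exponential-lower-bound {C} {Λ} {σ} {x} K 1≤C (0<Λ , Λ≤1) (0<σ , σ≤1) Λσᴷ<Cx =
  <⇒≤ (*-cancelˡ-<-0≤ 0≤C (begin-strict
    C * 1ℚ                         ≤⟨ *-mono-≤-0≤ 0≤C (nonNegative⁻¹ 1ℚ) C≤DΛ (1≤^ℚ K 1≤Dσ) ⟩
    D * Λ * (D * σ) ^ℚ K           ≡⟨ cong (D * Λ *_) (^ℚ-distribʳ-* D σ K) ⟩
    D * Λ * (D ^ℚ K * σ ^ℚ K)      ≡⟨ regroup D Λ (D ^ℚ K) (σ ^ℚ K) ⟩
    Λ * σ ^ℚ K * (D * D ^ℚ K)      <⟨ *-monoʳ-<-0< (*-pos 0<D (^ℚ-pos K 0<D)) Λσᴷ<Cx ⟩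
    C * x * (D * D ^ℚ K)           ≡⟨ *-assoc C x (D * D ^ℚ K) ⟩
    C * (x * (D * D ^ℚ K))         ≡⟨ cong (λ y → C * (x * y)) (sym (^ℚ-+1 D K)) ⟩
    C * (x * D ^ℚ (K ℕ.+ 1))       ∎))
  where
  open ≤-Reasoning
  D : ℚ
  D = C ÷₀ (Λ * σ)
  0≤C : 0ℚ ≤ C
  0≤C = ≤-trans (nonNegative⁻¹ 1ℚ) 1≤C
  0<Λσ : 0ℚ < Λ * σ
  0<Λσ = *-pos 0<Λ 0<σ
  DΛσ≡C : D * (Λ * σ) ≡ C
  DΛσ≡C = x÷₀y*y≡x C 0<Λσ
  0<D : 0ℚ < D
  0<D = 0<p*r⇒0<p (<⇒≤ 0<Λσ) (subst (0ℚ <_) (sym DΛσ≡C) (<-≤-trans (positive⁻¹ 1ℚ) 1≤C))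
  C≤DΛ : C ≤ D * Λ
  C≤DΛ = begin
    C                  ≡⟨ sym DΛσ≡C ⟩
    D * (Λ * σ)        ≡⟨ sym (*-assoc D Λ σ) ⟩
    D * Λ * σ          ≤⟨ *-monoˡ-≤-0≤ (<⇒≤ (*-pos 0<D 0<Λ)) σ≤1 ⟩
    D * Λ * 1ℚ         ≡⟨ *-identityʳ (D * Λ) ⟩
    D * Λ              ∎
  swap : ∀ D Λ σ → D * (Λ * σ) ≡ D * σ * Λ
  swap = solve-∀ ℚ-ring
  1≤Dσ : 1ℚ ≤ D * σ
  1≤Dσ = begin
    1ℚ                 ≤⟨ 1≤C ⟩
    C                  ≡⟨ sym DΛσ≡C ⟩
    D * (Λ * σ)        ≡⟨ swap D Λ σ ⟩
    D * σ * Λ          ≤⟨ *-monoˡ-≤-0≤ (<⇒≤ (*-pos 0<D 0<σ)) Λ≤1 ⟩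
    D * σ * 1ℚ         ≡⟨ *-identityʳ (D * σ) ⟩
    D * σ              ∎
  regroup : ∀ D Λ u v → D * Λ * (u * v) ≡ Λ * v * (D * u)
  regroup = solve-∀ ℚ-ring

1≤C÷₀p : ∀ {C p} → 1ℚ ≤ C → 0< p ≤1 → 1ℚ ≤ C ÷₀ p
1≤C÷₀p {C} {p} 1≤C (0<p , p≤1) = begin
  1ℚ              ≤⟨ 1≤C ⟩
  C               ≡⟨ sym (x÷₀y*y≡x C 0<p) ⟩
  C ÷₀ p * p      ≤⟨ *-monoˡ-≤-0≤ 0≤C÷₀p p≤1 ⟩
  C ÷₀ p * 1ℚ     ≡⟨ *-identityʳ (C ÷₀ p) ⟩
  C ÷₀ p          ∎
  where
  open ≤-Reasoning
  0≤C÷₀p : 0ℚ ≤ C ÷₀ p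
  0≤C÷₀p = 0≤p*r⇒0≤p 0<p (subst (0ℚ ≤_) (sym (x÷₀y*y≡x C 0<p)) (≤-trans (nonNegative⁻¹ 1ℚ) 1≤C))

rate-bound : ∀ {μ γ ν ε N S T e₀ e c} K →
  0ℚ < μ → 0ℚ < γ → 0ℚ < N → 0ℚ ≤ ν → 0ℚ ≤ S * (N - T) → S * (N - T) ≤ N * N →
  μ * μ * μ * γ * N < ℕtoℚ 4 * e₀ → (μ * μ * μ) ^ℚ K * e₀ ≤ e → e ≤ ε → ε < S - T →
  μ ^ℚ K * c ≤ ν → (S - T) + (S - T) ≤ e + (S * (N - T) * c + S * (N - T) * c) → γ * N ≤ S - T →
  μ * μ * μ * γ * γ * (μ * μ * μ * μ) ^ℚ K < ℕtoℚ 8 * (ν * ε)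
rate-bound {μ} {γ} {ν} {ε} {N} {S} {T} {e₀} {e} {c} K
  0<μ 0<γ 0<N 0≤ν 0≤W W≤N² initial-error error-decay e≤ε ε<S-T c-growth separation γN≤S-T =
  *-cancelˡ-<-0≤ (<⇒≤ 0<N) (begin-strict
    N * (μ * μ * μ * γ * γ * (μ * μ * μ * μ) ^ℚ K)
      ≡⟨ cong (λ p → N * (μ * μ * μ * γ * γ * p)) (^ℚ-distribʳ-* (μ * μ * μ) μ K) ⟩
    N * (μ * μ * μ * γ * γ * (ρᴷ * μᴷ))
      ≡⟨ regroup μ γ N ρᴷ μᴷ ⟩
    (μ * μ * μ * γ * N * ρᴷ) * (γ * μᴷ)
      <⟨ *-mono-<-0< (*-pos (*-pos (*-pos (*-pos (*-pos 0<μ 0<μ) 0<μ) 0<γ) 0<N) 0<ρᴷ) (*-pos 0<γ 0<μᴷ)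
           error-side entry-side ⟩
    (ℕtoℚ 4 * ε) * ((N + N) * ν)
      ≡⟨ solve (ε ∷ N ∷ ν ∷ []) ℚ-ring ⟩
    N * (ℕtoℚ 8 * (ν * ε)) ∎)
  where
  open ≤-Reasoning
  ρᴷ μᴷ : ℚ
  ρᴷ = (μ * μ * μ) ^ℚ K
  μᴷ = μ ^ℚ K
  0<ρᴷ : 0ℚ < ρᴷ
  0<ρᴷ = ^ℚ-pos K (*-pos (*-pos 0<μ 0<μ) 0<μ)
  0<μᴷ : 0ℚ < μᴷ
  0<μᴷ = ^ℚ-pos K 0<μ
  regroup : ∀ μ γ N r m → N * (μ * μ * μ * γ * γ * (r * m)) ≡ (μ * μ * μ * γ * N * r) * (γ * m)
  regroup = solve-∀ ℚ-ring
  error-side : μ * μ * μ * γ * N * ρᴷ < ℕtoℚ 4 * ε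
  error-side = begin-strict
    μ * μ * μ * γ * N * ρᴷ  <⟨ *-monoʳ-<-0< 0<ρᴷ initial-error ⟩
    ℕtoℚ 4 * e₀ * ρᴷ        ≡⟨ trans (*-assoc (ℕtoℚ 4) e₀ ρᴷ) (cong (ℕtoℚ 4 *_) (*-comm e₀ ρᴷ)) ⟩
    ℕtoℚ 4 * (ρᴷ * e₀)      ≤⟨ *-monoˡ-≤-0≤ (nonNegative⁻¹ (ℕtoℚ 4)) (≤-trans error-decay e≤ε) ⟩
    ℕtoℚ 4 * ε              ∎
  S-T<2Wc : S - T < S * (N - T) * c + S * (N - T) * c
  S-T<2Wc = <-by-difference ((e + (S * (N - T) * c + S * (N - T) * c) - ((S - T) + (S - T))) + ((S - T) - e))
    (solve (e ∷ S ∷ T ∷ N ∷ c ∷ []) ℚ-ring)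
    (+-nonNeg-pos (p≤q⇒0≤q-p separation) (p<q⇒0<q-p (≤-<-trans e≤ε ε<S-T)))
  entry-side : γ * μᴷ < (N + N) * ν
  entry-side = *-cancelˡ-<-0≤ (<⇒≤ 0<N) (begin-strict
    N * (γ * μᴷ)                                  ≡⟨ trans (sym (*-assoc N γ μᴷ)) (cong (_* μᴷ) (*-comm N γ)) ⟩
    γ * N * μᴷ                                    ≤⟨ *-monoʳ-≤-0≤ (<⇒≤ 0<μᴷ) γN≤S-T ⟩
    (S - T) * μᴷ                                  <⟨ *-monoʳ-<-0< 0<μᴷ S-T<2Wc ⟩
    (S * (N - T) * c + S * (N - T) * c) * μᴷ      ≡⟨ pull-out (S * (N - T)) c μᴷ ⟩
    (S * (N - T) + S * (N - T)) * (μᴷ * c)        ≤⟨ *-monoˡ-≤-0≤ (+-nonNeg 0≤W 0≤W) c-growth ⟩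
    (S * (N - T) + S * (N - T)) * ν               ≤⟨ *-monoʳ-≤-0≤ 0≤ν (+-mono-≤ W≤N² W≤N²) ⟩
    (N * N + N * N) * ν                           ≡⟨ solve (N ∷ ν ∷ []) ℚ-ring ⟩
    N * ((N + N) * ν)                             ∎)
    where
    pull-out : ∀ w c m → (w * c + w * c) * m ≡ (w + w) * (m * c)
    pull-out = solve-∀ ℚ-ring

module LowerBound {N S T μ γ : ℚ} (0<T : 0ℚ < T) (T<S : T < S) (S<N : S < N)
  (0<μ : 0ℚ < μ) (μ<1 : μ < 1ℚ) (μN≤T : μ * N ≤ T) (3μN≤N-S : ℕtoℚ 3 * (μ * N) ≤ N - S)
  (0<γ : 0ℚ < γ) (γN≤S-T : γ * N ≤ S - T) where

  open Weighted T (N - T) S (N - S)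

  0<S : 0ℚ < S
  0<S = <-trans 0<T T<S

  0<N : 0ℚ < N
  0<N = <-trans 0<S S<N

  0≤μN : 0ℚ ≤ μ * N
  0≤μN = *-nonNeg (<⇒≤ 0<μ) (<⇒≤ 0<N)

  μN≤N-S : μ * N ≤ N - S
  μN≤N-S = ≤-trans (≤-by-difference {q = ℕtoℚ 3 * (μ * N)} (ℕtoℚ 2 * (μ * N)) (solve (μ ∷ N ∷ []) ℚ-ring)
                      (*-nonNeg (nonNegative⁻¹ (ℕtoℚ 2)) 0≤μN)) 3μN≤N-S

  N-S≤N-T : N - S ≤ N - T
  N-S≤N-T = ≤-by-difference (S - T) (solve (N ∷ S ∷ T ∷ []) ℚ-ring) (p≤q⇒0≤q-p (<⇒≤ T<S))

  admissible : Admissible μ N T (N - T) S (N - S)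
  admissible = record
    { 0<μ = 0<μ ; 0≤n = <⇒≤ 0<N
    ; heights = solve (N ∷ T ∷ []) ℚ-ring ; widths = solve (N ∷ S ∷ []) ℚ-ring
    ; μn≤h₁ = μN≤T ; μn≤h₂ = ≤-trans μN≤N-S N-S≤N-T
    ; μn≤w₁ = ≤-trans μN≤T (<⇒≤ T<S) ; μn≤w₂ = μN≤N-S
    }

  μ-small : μ * (ℕtoℚ 6 * N + ℕtoℚ 5 * (N - T)) ≤ ℕtoℚ 5 * (N - T)
  μ-small = ≤-by-scaled-difference
    (ℕtoℚ 11 * ((N - S) - ℕtoℚ 3 * (μ * N)) + ℕtoℚ 4 * (N - T) + ℕtoℚ 11 * (S - T) + ℕtoℚ 15 * (μ * T))
    (positive⁻¹ (ℕtoℚ 3)) (solve (N ∷ S ∷ T ∷ μ ∷ []) ℚ-ring)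
    (+-nonNeg (+-nonNeg (+-nonNeg
      (*-nonNeg (nonNegative⁻¹ (ℕtoℚ 11)) (p≤q⇒0≤q-p 3μN≤N-S))
      (*-nonNeg (nonNegative⁻¹ (ℕtoℚ 4)) (<⇒≤ (p<q⇒0<q-p (<-trans T<S S<N)))))
      (*-nonNeg (nonNegative⁻¹ (ℕtoℚ 11)) (<⇒≤ (p<q⇒0<q-p T<S))))
      (*-nonNeg (nonNegative⁻¹ (ℕtoℚ 15)) (*-nonNeg (<⇒≤ 0<μ) (<⇒≤ 0<T))))

  module _ {ν θ₁₁ θ₁₂ θ₂₂ : ℚ} (0<ν : 0ℚ < ν)
    (0<θ₁₁ : 0ℚ < θ₁₁) (0<θ₁₂ : 0ℚ < θ₁₂) (0<θ₂₂ : 0ℚ < θ₂₂)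
    (θ₁₂-small : θ₁₂ < (ℕtoℚ 6 * N) ÷₀ (ℕtoℚ 6 * N * N + ℕtoℚ 5 * S * (N - T)))
    (row₁ : S * θ₁₁ + (N - S) * θ₁₂ ≡ 1ℚ) (row₂ : S * ν + (N - S) * θ₂₂ ≡ 1ℚ)
    (col₁-deficit : T * θ₁₁ + (N - T) * ν - 1ℚ < 0ℚ)
    (col₂-excess : (S * T * (S - T)) ÷₀ (ℕtoℚ 4 * (N ^ℚ 3)) < T * θ₁₂ + (N - T) * θ₂₂ - 1ℚ)
    where

    open Admissible admissible using (μn≤w₁; 0≤h₁; 0≤h₂; 0≤w₁; 0≤w₂; sizes)

    θ : Block
    θ = block θ₁₁ θ₁₂ ν θ₂₂

    0<N³ : 0ℚ < N ^ℚ 3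
    0<N³ = ^ℚ-pos 3 0<N

    0<4N³ : 0ℚ < ℕtoℚ 4 * N ^ℚ 3
    0<4N³ = *-pos (positive⁻¹ (ℕtoℚ 4)) 0<N³

    0<S-T : 0ℚ < S - T
    0<S-T = p<q⇒0<q-p T<S

    θ-regular : Regular μ θ
    θ-regular = InitialBlock.initial-regular 0<T T<S S<N μ<1 μ-small 0<θ₁₁ 0<θ₁₂ 0<ν 0<θ₂₂ row₁ row₂
      (p-q<0⇒p<q col₁-deficit)
      (<-by-difference _ refl (<-trans (÷₀-pos (*-pos (*-pos 0<S 0<T) 0<S-T) 0<4N³) col₂-excess))
      (x<y÷₀z⇒x*z<y (+-pos (*-pos (*-pos (positive⁻¹ (ℕtoℚ 6)) 0<N) 0<N)
                      (*-pos (*-pos (positive⁻¹ (ℕtoℚ 5)) 0<S) (p<q⇒0<q-p (<-trans T<S S<N))))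
               θ₁₂-small)

    -- The initial error is at least the excess of the second column block.
    initial-error : μ * μ * μ * γ * N < ℕtoℚ 4 * error θ
    initial-error = *-cancelˡ-<-0≤ (<⇒≤ 0<N³) (begin-strict
      N * (N * (N * 1ℚ)) * (μ * μ * μ * γ * N)
        ≡⟨ solve (N ∷ μ ∷ γ ∷ []) ℚ-ring ⟩
      (μ * N) * ((μ * N) * ((μ * N) * (γ * N)))
        ≤⟨ *-mono-≤-0≤ 0≤μN (*-nonNeg 0≤μN (*-nonNeg 0≤μN 0≤γN)) μN≤N-S
             (*-mono-≤-0≤ 0≤μN (*-nonNeg 0≤μN 0≤γN) μn≤w₁
               (*-mono-≤-0≤ 0≤μN 0≤γN μN≤T γN≤S-T)) ⟩
      (N - S) * (S * (T * (S - T)))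
        ≡⟨ cong ((N - S) *_) (sym (*-assoc S T (S - T))) ⟩
      (N - S) * (S * T * (S - T))
        <⟨ *-monoˡ-<-0< (p<q⇒0<q-p S<N) (y÷₀z<x⇒y<x*z 0<4N³ col₂-excess) ⟩
      (N - S) * ((T * θ₁₂ + (N - T) * θ₂₂ - 1ℚ) * (ℕtoℚ 4 * (N * (N * (N * 1ℚ)))))
        ≡⟨ solve (N ∷ S ∷ T ∷ θ₁₂ ∷ θ₂₂ ∷ []) ℚ-ring ⟩
      N * (N * (N * 1ℚ)) * (ℕtoℚ 4 * ((N - S) * (T * θ₁₂ + (N - T) * θ₂₂ - 1ℚ)))
        ≤⟨ *-monoˡ-≤-0≤ (<⇒≤ 0<N³) (*-monoˡ-≤-0≤ (nonNegative⁻¹ (ℕtoℚ 4))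
             (colSum₂-deviation≤error 0≤h₁ 0≤h₂ 0≤w₁ 0≤w₂ sizes θ)) ⟩
      N * (N * (N * 1ℚ)) * (ℕtoℚ 4 * error θ) ∎)
      where
      open ≤-Reasoning
      0≤γN : 0ℚ ≤ γ * N
      0≤γN = *-nonNeg (<⇒≤ 0<γ) (<⇒≤ 0<N)

    stopping-bound : ∀ {ε} K → error (blockSK θ K) ≤ ε → ε < S - T →
      μ * μ * μ * γ * γ * (μ * μ * μ * μ) ^ℚ K < ℕtoℚ 8 * (ν * ε)
    stopping-bound K stopped ε<S-T = rate-bound {S = S} {T = T} K 0<μ 0<γ 0<N (<⇒≤ 0<ν) 0≤W W≤N² initial-error
      error-decay stopped ε<S-T a₂₁-growth
      (error-separation 0≤h₁ 0≤h₂ 0≤w₁ 0≤w₂ sizes (blockSK θ K) (Regular.0≤a₁₂ regular))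
      γN≤S-T
      where
      open Iteration admissible using (invariant; module Invariant)
      open Invariant (invariant θ-regular (row₁ , row₂) K)
      0≤W : 0ℚ ≤ S * (N - T)
      0≤W = *-nonNeg (<⇒≤ 0<S) 0≤h₂
      W≤N² : S * (N - T) ≤ N * N
      W≤N² = ≤-by-difference (N * (N - S) + S * T) (solve (N ∷ S ∷ T ∷ []) ℚ-ring)
        (+-nonNeg (*-nonNeg (<⇒≤ 0<N) 0≤w₂) (*-nonNeg (<⇒≤ 0<S) (<⇒≤ 0<T)))

⅓ : ℚ
⅓ = ℤ.+ 1 / 3

module Constants {α β γ : ℚ} (0<α : 0ℚ < α) (α<1 : α < 1ℚ) (0<β : 0ℚ < β) (β<1 : β < 1ℚ)
  (0<γ : 0ℚ < γ) (γ<1 : γ < 1ℚ) where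

  μ : ℚ
  μ = α * (1ℚ - β) * ⅓

  0<μ : 0ℚ < μ
  0<μ = *-pos (*-pos 0<α (p<q⇒0<q-p β<1)) (positive⁻¹ ⅓)

  μ≤α : μ ≤ α
  μ≤α = ≤-by-difference {p = α * (1ℚ - β) * ⅓} (α * (⅓ + ⅓ + β * ⅓)) (solve (α ∷ β ∷ []) ℚ-ring)
    (*-nonNeg (<⇒≤ 0<α) (+-nonNeg (nonNegative⁻¹ (⅓ + ⅓)) (*-nonNeg (<⇒≤ 0<β) (nonNegative⁻¹ ⅓))))

  μ<1 : μ < 1ℚ
  μ<1 = ≤-<-trans μ≤α α<1

  0<μ≤1 : 0< μ ≤1
  0<μ≤1 = 0<μ , <⇒≤ μ<1

  Λ σ : ℚ
  Λ = μ * μ * μ * γ * γ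
  σ = μ * μ * μ * μ

  0<Λ≤1 : 0< Λ ≤1
  0<Λ≤1 = *-0<≤1 (*-0<≤1 (*-0<≤1 (*-0<≤1 0<μ≤1 0<μ≤1) 0<μ≤1) (0<γ , <⇒≤ γ<1)) (0<γ , <⇒≤ γ<1)

  0<σ≤1 : 0< σ ≤1
  0<σ≤1 = *-0<≤1 (*-0<≤1 (*-0<≤1 0<μ≤1 0<μ≤1) 0<μ≤1) 0<μ≤1

  D : ℚ
  D = ℕtoℚ 8 ÷₀ (Λ * σ)

  1≤8 : 1ℚ ≤ ℕtoℚ 8
  1≤8 = ℕtoℚ-mono-≤ {1} {8} (ℕ.s≤s ℕ.z≤n)

  1≤D : 1ℚ ≤ D
  1≤D = 1≤C÷₀p 1≤8 (*-0<≤1 0<Λ≤1 0<σ≤1)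

  βN<N : ∀ {N} → 0ℚ < N → β * N < N
  βN<N {N} 0<N = <-by-difference ((1ℚ - β) * N) (solve (β ∷ N ∷ []) ℚ-ring) (*-pos (p<q⇒0<q-p β<1) 0<N)

  module _ {N S T : ℚ} (0≤N : 0ℚ ≤ N) (αN≤T : α * N ≤ T) (S≤βN : S ≤ β * N) where

    μN≤T : μ * N ≤ T
    μN≤T = ≤-trans (*-monoʳ-≤-0≤ 0≤N μ≤α) αN≤T

    3μN≤N-S : ℕtoℚ 3 * (μ * N) ≤ N - S
    3μN≤N-S = begin
      ℕtoℚ 3 * (α * (1ℚ - β) * ⅓ * N)  ≡⟨ solve (α ∷ β ∷ N ∷ []) ℚ-ring ⟩
      α * ((1ℚ - β) * N) ≤⟨ *-monoʳ-≤-0≤ (*-nonNeg (<⇒≤ (p<q⇒0<q-p β<1)) 0≤N) (<⇒≤ α<1) ⟩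
      1ℚ * ((1ℚ - β) * N) ≡⟨ solve (β ∷ N ∷ []) ℚ-ring ⟩
      N - β * N          ≤⟨ +-monoʳ-≤ N (neg-antimono-≤ S≤βN) ⟩
      N - S              ∎
      where open ≤-Reasoning

theorem6p1 : (α β γ : ℚ) → 0ℚ < α → α < 1ℚ → 0ℚ < β → β < 1ℚ → 0ℚ < γ → γ < 1ℚ →
  Σ ℚ (λ D → Σ ℕ (λ M → 1ℚ ≤ D ×
    ((n s t : ℕ) → 0 ℕ.< n → 0 ℕ.< s → 0 ℕ.< t →
     α * ℕtoℚ n ≤ ℕtoℚ t → t ℕ.< s → ℕtoℚ s ≤ β * ℕtoℚ n →
     γ * ℕtoℚ n ≤ ℕtoℚ s - ℕtoℚ t →
     (ε ν θ₁₁ θ₁₂ θ₂₁ θ₂₂ : ℚ) →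
     0ℚ < ε → ε < ℕtoℚ s - ℕtoℚ t → 0ℚ < ν →
     0ℚ < θ₁₁ → 0ℚ < θ₁₂ → 0ℚ < θ₂₁ → 0ℚ < θ₂₂ →
     θ₂₁ ≡ ν →
     θ₁₂ < (ℕtoℚ 6 * ℕtoℚ n) ÷₀ (ℕtoℚ 6 * ℕtoℚ n * ℕtoℚ n + ℕtoℚ 5 * ℕtoℚ s * (ℕtoℚ n - ℕtoℚ t)) →
     ℕtoℚ s * θ₁₁ + (ℕtoℚ n - ℕtoℚ s) * θ₁₂ ≡ 1ℚ →
     ℕtoℚ s * θ₂₁ + (ℕtoℚ n - ℕtoℚ s) * θ₂₂ ≡ 1ℚ →
     (ℕtoℚ t - ℕtoℚ n) ÷₀ ℕtoℚ n < ℕtoℚ t * θ₁₁ + (ℕtoℚ n - ℕtoℚ t) * θ₂₁ - 1ℚ →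
     ℕtoℚ t * θ₁₁ + (ℕtoℚ n - ℕtoℚ t) * θ₂₁ - 1ℚ < 0ℚ →
     (ℕtoℚ s * ℕtoℚ t * (ℕtoℚ s - ℕtoℚ t)) ÷₀ (ℕtoℚ 4 * (ℕtoℚ n ^ℚ 3)) < ℕtoℚ t * θ₁₂ + (ℕtoℚ n - ℕtoℚ t) * θ₂₂ - 1ℚ →
     ℕtoℚ t * θ₁₂ + (ℕtoℚ n - ℕtoℚ t) * θ₂₂ - 1ℚ < (ℕtoℚ s * (ℕtoℚ n - ℕtoℚ t)) ÷₀ (ℕtoℚ n * (ℕtoℚ n - ℕtoℚ s)) →
     (K : ℕ) →
     marginalError (SK (blockMatrix n s t θ₁₁ θ₁₂ θ₂₁ θ₂₂) K) ≤ ε →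
     ((k : ℕ) → k ℕ.< K → ¬ (marginalError (SK (blockMatrix n s t θ₁₁ θ₁₂ θ₂₁ θ₂₂) k) ≤ ε)) →
     1ℚ ≤ (ν * ε) * (D ^ℚ (K ℕ.+ M)))))
theorem6p1 α β γ 0<α α<1 0<β β<1 0<γ γ<1 = D , 1 , 1≤D , λ where
    n s t 0<n _ 0<t αN≤T t<s S≤βN γN≤S-T ε ν θ₁₁ θ₁₂ .ν θ₂₂ _ ε<S-T 0<ν 0<θ₁₁ 0<θ₁₂ _ 0<θ₂₂ refl
      θ₁₂-small row₁ row₂ _ col₁-deficit col₂-excess _ K stopped _ →
      let S<N : ℕtoℚ s < ℕtoℚ n
          S<N = ≤-<-trans S≤βN (βN<N (ℕtoℚ-mono-< 0<n))
          s≤n : s ℕ.≤ n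
          s≤n = ℕP.<⇒≤ (ℕtoℚ-cancel-< S<N)
          open BlockMatrix n s t s≤n (ℕP.≤-trans (ℕP.<⇒≤ t<s) s≤n)
      in exponential-lower-bound {x = ν * ε} K 1≤8 0<Λ≤1 0<σ≤1
           (LowerBound.stopping-bound (ℕtoℚ-mono-< 0<t) (ℕtoℚ-mono-< t<s) S<N 0<μ μ<1
              (μN≤T (0≤ℕtoℚ n) αN≤T S≤βN) (3μN≤N-S (0≤ℕtoℚ n) αN≤T S≤βN) 0<γ γN≤S-T
              0<ν 0<θ₁₁ 0<θ₁₂ 0<θ₂₂ θ₁₂-small row₁ row₂ col₁-deficit col₂-excess K
              (subst (_≤ ε) (marginalError-SK (block θ₁₁ θ₁₂ ν θ₂₂) K) stopped) ε<S-T)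
  where open Constants 0<α α<1 0<β β<1 0<γ γ<1
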